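{- Let $r_1,r_2\ge 1$ and $N\ge \ell_2\ge 0$ be integers, and let \[S_N=\sum_{n=1}^{N}\frac{\zeta_{n-1}(\{1\}_{\ell_2})}{\binom{n+r_1}{r_1}n^{r_2}}.\] Then \[S_N=\sum_{m=2}^{r_2}(-1)^{r_2-m}\zeta_N(m,\{1\}_{\ell_2})\,\zeta^{\ast}_{r_1}(\{1\}_{r_2-m})+K(r_1,r_2,\ell_2)+E_N(r_1,r_2,\ell_2),\] (the sum over $m$ being empty if $r_2=1$), where \[K(r_1,r_2,\ell_2)=\begin{cases}(-1)^{r_2+1}\zeta^{\ast}_{r_1}(\{1\}_{r_2-2},\ell_2+2), & r_2\ge 2,\\ \dfrac{1}{r_1^{\ell_2+1}}, & r_2=1,\end{cases}\] \[E_N(r_1,r_2,\ell_2)=(-1)^{r_2+1}\sum_{k_0=1}^{r_1}\binom{r_1}{k_0}\frac{(-1)^{k_0+1}}{k_0^{r_2-1}}R_N(\ell_2,k_0),\] and \[R_N(\ell_2,k_0)=\sum_{j=0}^{\ell_2}\left[\sum_{k_1=1}^{k_0}\frac{1}{k_1}\sum_{k_2=1}^{k_1}\frac{1}{k_2}\cdots\sum_{k_j=1}^{k_{j-1}}\frac{1}{k_j}\cdot\zeta_{N-1-j}(\{1\}_{\ell_2-j})\,\big(H_{N-j}-H_{N-j+k_j}\big)\right],\] where for $j=0$ there are no nested sums and the summand is $\zeta_{N-1}(\{1\}_{\ell_2})(H_N-H_{N+k_0})$. Moreover, $\lim_{N\to\infty}E_N(r_1,r_2,\ell_2)=0$, so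 that $\lim_{N\to\infty}S_N=\sum_{n\ge1}\frac{\zeta_{n-1}(\{1\}_{\ell_2})}{\binom{n+r_1}{r_1}n^{r_2}}$.
   Context: For integers $N\ge 0$ and positive integers $i_1,\dots,i_k$, $\zeta_N(i_1,\dots,i_k)=\sum_{N\ge n_1>\cdots>n_k\ge 1}\frac{1}{n_1^{i_1}\cdots n_k^{i_k}}$ and $\zeta^{\ast}_N(i_1,\dots,i_k)=\sum_{N\ge n_1\ge\cdots\ge n_k\ge 1}\frac{1}{n_1^{i_1}\cdots n_k^{i_k}}$ (empty sums are $0$). $\{1\}_m$ denotes $1$ repeated $m$ times, and by convention $\zeta_n(\{1\}_0)=\zeta^{\ast}_n(\{1\}_0)=1$ for arbitrary $n$ (including $n=-1$). $H_n=\sum_{j=1}^n\frac1j$ is the $n$th harmonic number. -}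

module Defs where

open import Data.Nat as ℕ using (ℕ; zero; suc; _∸_; _^_)
import Data.Nat.Combinatorics as C
open import Data.Integer using (+_)
open import Data.Rational using (ℚ; 0ℚ; 1ℚ; _+_; _*_; _-_; -_; _/_)
open import Data.List using (List; []; _∷_; replicate; _++_)

-- reciprocal of a natural number, as a rational (only ever applied to
-- positive arguments; the value at 0 is an irrelevant convention)
inv : ℕ → ℚ
inv zero    = 0ℚ
inv (suc n) = + 1 / suc n

ℕtoℚ : ℕ → ℚ
ℕtoℚ n = + n / 1

neg1^ : ℕ → ℚ
neg1^ zero    = 1ℚ
neg1^ (suc k) = - neg1^ k

-- sumFT a b f = Σ_{k=a}^{b} f k   (empty, i.e. 0, if b < a)
sumFT : ℕ → ℕ → (ℕ → ℚ) → ℚ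
sumFT a b f = go (suc b ∸ a)
  where
  go : ℕ → ℚ
  go zero    = 0ℚ
  go (suc n) = go n + f (a ℕ.+ n)

-- ζ_N(i₁,…,i_k) = Σ_{N ≥ n₁ > ⋯ > n_k ≥ 1} 1/(n₁^{i₁}⋯n_k^{i_k}); ζ_N() = 1
zetaN : ℕ → List ℕ → ℚ
zetaN N []       = 1ℚ
zetaN N (i ∷ is) = sumFT 1 N (λ n → inv (n ^ i) * zetaN (n ∸ 1) is)

-- ζ*_N(i₁,…,i_k) = Σ_{N ≥ n₁ ≥ ⋯ ≥ n_k ≥ 1} 1/(n₁^{i₁}⋯n_k^{i_k}); ζ*_N() = 1
zetaStar : ℕ → List ℕ → ℚ
zetaStar N []       = 1ℚ
zetaStar N (i ∷ is) = sumFT 1 N (λ n → inv (n ^ i) * zetaStar n is)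

ones : ℕ → List ℕ
ones m = replicate m 1

H : ℕ → ℚ
H n = sumFT 1 n inv

binomQ : ℕ → ℕ → ℚ
binomQ n k = ℕtoℚ (n C.C k)

S : ℕ → ℕ → ℕ → ℕ → ℚ
S r₁ r₂ ℓ₂ N =
  sumFT 1 N (λ n → zetaN (n ∸ 1) (ones ℓ₂) * inv (((n ℕ.+ r₁) C.C r₁) ℕ.* (n ^ r₂)))

-- nest j k f = Σ_{k₁=1}^{k} 1/k₁ Σ_{k₂=1}^{k₁} 1/k₂ ⋯ Σ_{k_j=1}^{k_{j-1}} 1/k_j · f k_j
-- (nest 0 k f = f k)
nest : ℕ → ℕ → (ℕ → ℚ) → ℚ
nest zero    k f = f k
nest (suc j) k f = sumFT 1 k (λ k₁ → inv k₁ * nest j k₁ f)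

R : ℕ → ℕ → ℕ → ℚ
R N ℓ₂ k₀ = sumFT 0 ℓ₂ (λ j →
  nest j k₀ (λ kⱼ → zetaN (N ∸ 1 ∸ j) (ones (ℓ₂ ∸ j))
                     * (H (N ∸ j) - H ((N ∸ j) ℕ.+ kⱼ))))

E : ℕ → ℕ → ℕ → ℕ → ℚ
E r₁ r₂ ℓ₂ N = neg1^ (suc r₂) * sumFT 1 r₁ (λ k₀ →
  binomQ r₁ k₀ * neg1^ (suc k₀) * inv (k₀ ^ (r₂ ∸ 1)) * R N ℓ₂ k₀)

K : ℕ → ℕ → ℕ → ℚ
K r₁ zero          ℓ₂ = 0ℚ   -- r₂ = 0 is excluded by hypothesis
K r₁ (suc zero)    ℓ₂ = inv (r₁ ^ suc ℓ₂)
K r₁ (suc (suc t)) ℓ₂ = neg1^ (suc (suc (suc t))) * zetaStar r₁ (ones t ++ (ℓ₂ ℕ.+ 2 ∷ []))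

mainSum : ℕ → ℕ → ℕ → ℕ → ℚ
mainSum r₁ r₂ ℓ₂ N = sumFT 2 r₂ (λ m →
  neg1^ (r₂ ∸ m) * zetaN N (m ∷ ones ℓ₂) * zetaStar r₁ (ones (r₂ ∸ m)))

-- The identity is proved by induction on r₂.  For r₂ = 1, partial fractions
--   1/(n·C(n+r,r)) = Σ_{k=1}^{r} C(r,k) (-1)^{k+1} (1/n - 1/(n+k))
-- reduce S_N to the telescoping sums Σ_{n≤N} ζ_{n-1}({1}_ℓ)(1/n - 1/(n+k)),
-- which equal ζ*_k({1}_{ℓ+1}) + R_N(ℓ,k) for N ≥ ℓ (summation by parts);
-- the binomial transform Σ_k C(r,k)(-1)^{k+1} ζ*_k({1}_a) = 1/r^a then
-- produces K, and the R-part is E.  For the step, the relation between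
-- 1/C(n+r,r) and 1/C(n+r-1,r-1) gives S(r,s+1) = ζ_N(s+1,{1}_ℓ) - Σ_{k≤r} S(k,s)/k,
-- and mainSum, K and E satisfy the same recursion.
-- For the limit, each summand of R_N is at most κ·H_M^a/(M+1) in absolute value,
-- H_M^{2a} ≤ c(M+1) makes this tend to 0, and convergence to 0 is closed under
-- the finite sums, constant multiples and shifts from which E_N is built.
module Submission where

open import Defs
open import Data.Nat as ℕ using (ℕ; zero; suc; _≤_; z≤n; s≤s; _∸_; _^_)
import Data.Nat.Properties as ℕP
open import Data.Nat.Combinatorics as C using (_C_)
open import Data.Integer as ℤ using ()
open import Data.Integer.Tactic.RingSolver using (solve-∀)
open import Data.Rational as Q using (ℚ; 0ℚ; 1ℚ; _+_; _*_; _-_; -_; _<_; ∣_∣; _/_; toℚᵘ; mkℚ)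
  renaming (_≤_ to _≤ℚ_)
import Data.Rational.Properties as QP
import Data.Rational.Unnormalised as UQ
import Data.Rational.Unnormalised.Properties as UP
open import Data.Rational.Solver
open +-*-Solver
open import Data.Product using (∃; _,_; proj₁; proj₂; _×_)
open import Data.List using ([]; _∷_; _++_)
open import Relation.Nullary using (yes; no)
open import Data.Empty using (⊥-elim)
open import Relation.Binary.PropositionalEquality

-- Equalities of normalised rationals are checked on unnormalised representatives.
toℚᵘ-/ : ∀ i d → toℚᵘ (i / suc d) UQ.≃ UQ.mkℚᵘ i d
toℚᵘ-/ i d = QP.toℚᵘ-fromℚᵘ (UQ.mkℚᵘ i d)

ℕtoℚ-suc : ∀ n → ℕtoℚ (suc n) ≡ 1ℚ + ℕtoℚ n
ℕtoℚ-suc n = QP.toℚᵘ-injective (begin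
  toℚᵘ (ℕtoℚ (suc n))                ≈⟨ toℚᵘ-/ (ℤ.+ suc n) 0 ⟩
  UQ.mkℚᵘ (ℤ.+ suc n) 0              ≈⟨ UQ.*≡* (cross (ℤ.+ n)) ⟩
  toℚᵘ 1ℚ UQ.+ UQ.mkℚᵘ (ℤ.+ n) 0     ≈⟨ UP.+-congʳ (toℚᵘ 1ℚ) (UP.≃-sym (toℚᵘ-/ (ℤ.+ n) 0)) ⟩
  toℚᵘ 1ℚ UQ.+ toℚᵘ (ℕtoℚ n)         ≈⟨ UP.≃-sym (QP.toℚᵘ-homo-+ 1ℚ (ℕtoℚ n)) ⟩
  toℚᵘ (1ℚ + ℕtoℚ n)                 ∎)
  where
  open UP.≃-Reasoning
  cross : ∀ x → (ℤ.+ 1 ℤ.+ x) ℤ.* ℤ.+ 1 ≡ (ℤ.+ 1 ℤ.+ x ℤ.* ℤ.+ 1) ℤ.* (ℤ.+ 1 ℤ.* ℤ.+ 1)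
  cross = solve-∀

inv*ℕ≡1 : ∀ n → inv (suc n) * ℕtoℚ (suc n) ≡ 1ℚ
inv*ℕ≡1 n = QP.toℚᵘ-injective (begin
  toℚᵘ (inv (suc n) * ℕtoℚ (suc n))                     ≈⟨ QP.toℚᵘ-homo-* (inv (suc n)) (ℕtoℚ (suc n)) ⟩
  toℚᵘ (inv (suc n)) UQ.* toℚᵘ (ℕtoℚ (suc n))           ≈⟨ UP.*-cong (toℚᵘ-/ (ℤ.+ 1) n) (toℚᵘ-/ (ℤ.+ suc n) 0) ⟩
  UQ.mkℚᵘ (ℤ.+ 1) n UQ.* UQ.mkℚᵘ (ℤ.+ suc n) 0         ≈⟨ UQ.*≡* (cross (ℤ.+ n)) ⟩
  toℚᵘ 1ℚ                                               ∎)
  where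
  open UP.≃-Reasoning
  cross : ∀ x → (ℤ.+ 1 ℤ.* (ℤ.+ 1 ℤ.+ x)) ℤ.* ℤ.+ 1 ≡ ℤ.+ 1 ℤ.* ((ℤ.+ 1 ℤ.+ x) ℤ.* ℤ.+ 1)
  cross = solve-∀

ℕ*inv≡1 : ∀ n → ℕtoℚ (suc n) * inv (suc n) ≡ 1ℚ
ℕ*inv≡1 n = trans (QP.*-comm (ℕtoℚ (suc n)) (inv (suc n))) (inv*ℕ≡1 n)

ℕtoℚ-+ : ∀ m n → ℕtoℚ (m ℕ.+ n) ≡ ℕtoℚ m + ℕtoℚ n
ℕtoℚ-+ zero    n = sym (QP.+-identityˡ (ℕtoℚ n))
ℕtoℚ-+ (suc m) n = begin
  ℕtoℚ (suc (m ℕ.+ n))      ≡⟨ ℕtoℚ-suc (m ℕ.+ n) ⟩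
  1ℚ + ℕtoℚ (m ℕ.+ n)       ≡⟨ cong (1ℚ +_) (ℕtoℚ-+ m n) ⟩
  1ℚ + (ℕtoℚ m + ℕtoℚ n)    ≡⟨ sym (QP.+-assoc 1ℚ (ℕtoℚ m) (ℕtoℚ n)) ⟩
  (1ℚ + ℕtoℚ m) + ℕtoℚ n    ≡⟨ cong (_+ ℕtoℚ n) (sym (ℕtoℚ-suc m)) ⟩
  ℕtoℚ (suc m) + ℕtoℚ n     ∎
  where open ≡-Reasoning

ℕtoℚ-* : ∀ m n → ℕtoℚ (m ℕ.* n) ≡ ℕtoℚ m * ℕtoℚ n
ℕtoℚ-* zero    n = sym (QP.*-zeroˡ (ℕtoℚ n))
ℕtoℚ-* (suc m) n = begin
  ℕtoℚ (n ℕ.+ m ℕ.* n)         ≡⟨ ℕtoℚ-+ n (m ℕ.* n) ⟩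
  ℕtoℚ n + ℕtoℚ (m ℕ.* n)      ≡⟨ cong (ℕtoℚ n +_) (ℕtoℚ-* m n) ⟩
  ℕtoℚ n + ℕtoℚ m * ℕtoℚ n     ≡⟨ solve 2 (λ a b → b :+ a :* b := (con 1ℚ :+ a) :* b) refl (ℕtoℚ m) (ℕtoℚ n) ⟩
  (1ℚ + ℕtoℚ m) * ℕtoℚ n       ≡⟨ cong (_* ℕtoℚ n) (sym (ℕtoℚ-suc m)) ⟩
  ℕtoℚ (suc m) * ℕtoℚ n        ∎
  where open ≡-Reasoning

inv-unique : ∀ n x → x * ℕtoℚ (suc n) ≡ 1ℚ → x ≡ inv (suc n)
inv-unique n x x*n≡1 = begin
  x                                    ≡⟨ sym (QP.*-identityʳ x) ⟩
  x * 1ℚ                               ≡⟨ cong (x *_) (sym (inv*ℕ≡1 n)) ⟩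
  x * (inv (suc n) * ℕtoℚ (suc n))     ≡⟨ solve 3 (λ x i a → x :* (i :* a) := (x :* a) :* i) refl x (inv (suc n)) (ℕtoℚ (suc n)) ⟩
  (x * ℕtoℚ (suc n)) * inv (suc n)     ≡⟨ cong (_* inv (suc n)) x*n≡1 ⟩
  1ℚ * inv (suc n)                     ≡⟨ QP.*-identityˡ _ ⟩
  inv (suc n)                          ∎
  where open ≡-Reasoning

-- 1/(ab) = (1/a)(1/b), also in the degenerate cases thanks to inv 0 = 0.
inv-* : ∀ a b → inv (a ℕ.* b) ≡ inv a * inv b
inv-* zero    b = sym (QP.*-zeroˡ (inv b))
inv-* (suc a) zero rewrite ℕP.*-zeroʳ a = sym (QP.*-zeroʳ (inv (suc a)))
inv-* (suc a) (suc b) = sym (inv-unique (b ℕ.+ a ℕ.* suc b) (x * y) (begin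
  (x * y) * ℕtoℚ (suc a ℕ.* suc b)     ≡⟨ cong ((x * y) *_) (ℕtoℚ-* (suc a) (suc b)) ⟩
  (x * y) * (A * B)                    ≡⟨ solve 4 (λ x y u v → (x :* y) :* (u :* v) := (x :* u) :* (y :* v)) refl x y A B ⟩
  (x * A) * (y * B)                    ≡⟨ cong₂ _*_ (inv*ℕ≡1 a) (inv*ℕ≡1 b) ⟩
  1ℚ                                   ∎))
  where
  open ≡-Reasoning
  x = inv (suc a)
  y = inv (suc b)
  A = ℕtoℚ (suc a)
  B = ℕtoℚ (suc b)

infixr 8 _^ℚ_
_^ℚ_ : ℚ → ℕ → ℚ
x ^ℚ zero  = 1ℚ
x ^ℚ suc k = x * x ^ℚ k

inv-^ : ∀ n k → inv (n ^ k) ≡ inv n ^ℚ k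
inv-^ n zero    = refl
inv-^ n (suc k) = trans (inv-* n (n ^ k)) (cong (inv n *_) (inv-^ n k))

inv-^1 : ∀ n → inv (n ^ 1) ≡ inv n
inv-^1 n = cong inv (ℕP.*-identityʳ n)

inv-difference : ∀ a d → inv (suc a) - inv (suc a ℕ.+ d) ≡ ℕtoℚ d * inv (suc a) * inv (suc a ℕ.+ d)
inv-difference a d = begin
  u - w                          ≡⟨ cong₂ _-_ (sym (trans (cong (u *_) w*[A+D]≡1) (QP.*-identityʳ u)))
                                              (sym (trans (cong (w *_) (inv*ℕ≡1 a)) (QP.*-identityʳ w))) ⟩
  u * (w * (A + D)) - w * (u * A) ≡⟨ solve 4 (λ u w A D → u :* (w :* (A :+ D)) :- w :* (u :* A) := D :* u :* w) refl u w A D ⟩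
  D * u * w                      ∎
  where
  open ≡-Reasoning
  u = inv (suc a)
  w = inv (suc a ℕ.+ d)
  A = ℕtoℚ (suc a)
  D = ℕtoℚ d
  w*[A+D]≡1 : w * (A + D) ≡ 1ℚ
  w*[A+D]≡1 = trans (cong (w *_) (sym (ℕtoℚ-+ (suc a) d))) (inv*ℕ≡1 (a ℕ.+ d))

Σ₁ : ℕ → (ℕ → ℚ) → ℚ
Σ₁ n f = sumFT 1 n f

Σ₀ : ℕ → (ℕ → ℚ) → ℚ
Σ₀ n f = sumFT 0 n f

Σ₁-cong : ∀ n {f g : ℕ → ℚ} → (∀ k → 1 ≤ k → k ≤ n → f k ≡ g k) → Σ₁ n f ≡ Σ₁ n g
Σ₁-cong zero    f≡g = refl
Σ₁-cong (suc n) f≡g = cong₂ _+_ (Σ₁-cong n (λ k 1≤k k≤n → f≡g k 1≤k (ℕP.m≤n⇒m≤1+n k≤n)))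
                                (f≡g (suc n) (s≤s z≤n) ℕP.≤-refl)

Σ₁-ext : ∀ n {f g : ℕ → ℚ} → (∀ k → f k ≡ g k) → Σ₁ n f ≡ Σ₁ n g
Σ₁-ext n f≡g = Σ₁-cong n (λ k _ _ → f≡g k)

Σ₁-+ : ∀ n (f g : ℕ → ℚ) → Σ₁ n (λ k → f k + g k) ≡ Σ₁ n f + Σ₁ n g
Σ₁-+ zero    f g = refl
Σ₁-+ (suc n) f g = trans (cong (_+ (f (suc n) + g (suc n))) (Σ₁-+ n f g))
  (solve 4 (λ a b c d → (a :+ b) :+ (c :+ d) := (a :+ c) :+ (b :+ d)) refl (Σ₁ n f) (Σ₁ n g) (f (suc n)) (g (suc n)))

Σ₁-* : ∀ n c (f : ℕ → ℚ) → Σ₁ n (λ k → c * f k) ≡ c * Σ₁ n f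
Σ₁-* zero    c f = sym (QP.*-zeroʳ c)
Σ₁-* (suc n) c f = trans (cong (_+ (c * f (suc n))) (Σ₁-* n c f)) (sym (QP.*-distribˡ-+ c (Σ₁ n f) (f (suc n))))

Σ₁-zero : ∀ n → Σ₁ n (λ _ → 0ℚ) ≡ 0ℚ
Σ₁-zero zero    = refl
Σ₁-zero (suc n) = trans (QP.+-identityʳ _) (Σ₁-zero n)

Σ₁-neg : ∀ n (f : ℕ → ℚ) → Σ₁ n (λ k → - f k) ≡ - Σ₁ n f
Σ₁-neg zero    f = refl
Σ₁-neg (suc n) f = trans (cong (_+ (- f (suc n))) (Σ₁-neg n f)) (sym (QP.neg-distrib-+ (Σ₁ n f) (f (suc n))))

Σ₁-swap : ∀ n m (F : ℕ → ℕ → ℚ) → Σ₁ n (λ i → Σ₁ m (F i)) ≡ Σ₁ m (λ j → Σ₁ n (λ i → F i j))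
Σ₁-swap zero    m F = sym (Σ₁-zero m)
Σ₁-swap (suc n) m F = trans (cong (_+ Σ₁ m (F (suc n))) (Σ₁-swap n m F)) (sym (Σ₁-+ m _ _))

Σ₁-sub : ∀ n c (f h : ℕ → ℚ) → Σ₁ n (λ k → f k - c * h k) ≡ Σ₁ n f - c * Σ₁ n h
Σ₁-sub n c f h = trans (Σ₁-+ n f (λ k → - (c * h k))) (cong (Σ₁ n f +_) (trans (Σ₁-neg n (λ k → c * h k)) (cong -_ (Σ₁-* n c h))))

Σ₀-split : ∀ n (f : ℕ → ℚ) → Σ₀ n f ≡ f 0 + Σ₁ n f
Σ₀-split zero    f = trans (QP.+-identityˡ (f 0)) (sym (QP.+-identityʳ (f 0)))
Σ₀-split (suc n) f = trans (cong (_+ f (suc n)) (Σ₀-split n f)) (QP.+-assoc (f 0) (Σ₁ n f) (f (suc n)))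

Σ₁-suc : ∀ n (f : ℕ → ℚ) → Σ₁ (suc n) f ≡ Σ₀ n (λ j → f (suc j))
Σ₁-suc zero    f = refl
Σ₁-suc (suc n) f = cong (_+ f (suc (suc n))) (Σ₁-suc n f)

Σ₀-suc : ∀ n (f : ℕ → ℚ) → Σ₀ (suc n) f ≡ f 0 + Σ₀ n (λ j → f (suc j))
Σ₀-suc n f = trans (Σ₀-split (suc n) f) (cong (f 0 +_) (Σ₁-suc n f))

Σ₂-shift : ∀ t (f : ℕ → ℚ) → sumFT 2 (suc t) f ≡ Σ₁ t (λ i → f (suc i))
Σ₂-shift zero    f = refl
Σ₂-shift (suc t) f = cong (_+ f (suc (suc t))) (Σ₂-shift t f)

Σ₀-ext : ∀ n {f g : ℕ → ℚ} → (∀ k → f k ≡ g k) → Σ₀ n f ≡ Σ₀ n g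
Σ₀-ext zero    f≡g = cong (0ℚ +_) (f≡g 0)
Σ₀-ext (suc n) f≡g = cong₂ _+_ (Σ₀-ext n f≡g) (f≡g (suc n))

Σ₀-+ : ∀ n (f g : ℕ → ℚ) → Σ₀ n (λ k → f k + g k) ≡ Σ₀ n f + Σ₀ n g
Σ₀-+ zero    f g = solve 2 (λ a b → con 0ℚ :+ (a :+ b) := (con 0ℚ :+ a) :+ (con 0ℚ :+ b)) refl (f 0) (g 0)
Σ₀-+ (suc n) f g = trans (cong (_+ (f (suc n) + g (suc n))) (Σ₀-+ n f g))
  (solve 4 (λ a b c d → (a :+ b) :+ (c :+ d) := (a :+ c) :+ (b :+ d)) refl (Σ₀ n f) (Σ₀ n g) (f (suc n)) (g (suc n)))

Σ₀-* : ∀ n c (f : ℕ → ℚ) → Σ₀ n (λ k → c * f k) ≡ c * Σ₀ n f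
Σ₀-* zero    c f = trans (QP.+-identityˡ _) (cong (c *_) (sym (QP.+-identityˡ (f 0))))
Σ₀-* (suc n) c f = trans (cong (_+ (c * f (suc n))) (Σ₀-* n c f)) (sym (QP.*-distribˡ-+ c (Σ₀ n f) (f (suc n))))

Σ₀-neg : ∀ n (f : ℕ → ℚ) → Σ₀ n (λ k → - f k) ≡ - Σ₀ n f
Σ₀-neg zero    f = trans (QP.+-identityˡ _) (cong -_ (sym (QP.+-identityˡ (f 0))))
Σ₀-neg (suc n) f = trans (cong (_+ (- f (suc n))) (Σ₀-neg n f)) (sym (QP.neg-distrib-+ (Σ₀ n f) (f (suc n))))

Σ₀-Σ₁-swap : ∀ n m (F : ℕ → ℕ → ℚ) → Σ₀ n (λ i → Σ₁ m (F i)) ≡ Σ₁ m (λ j → Σ₀ n (λ i → F i j))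
Σ₀-Σ₁-swap zero    m F = trans (QP.+-identityˡ _) (Σ₁-ext m (λ j → sym (QP.+-identityˡ (F 0 j))))
Σ₀-Σ₁-swap (suc n) m F = trans (cong (_+ Σ₁ m (F (suc n))) (Σ₀-Σ₁-swap n m F)) (sym (Σ₁-+ m _ _))

absorption : ∀ m k → suc k ℕ.* (suc m C suc k) ≡ suc m ℕ.* (m C k)
absorption zero    zero    = refl
absorption zero    (suc k) = begin
  suc (suc k) ℕ.* (1 C suc (suc k))   ≡⟨ cong (suc (suc k) ℕ.*_) (C.k>n⇒nCk≡0 {1} {suc (suc k)} (s≤s (s≤s z≤n))) ⟩
  suc (suc k) ℕ.* 0                   ≡⟨ ℕP.*-zeroʳ (suc (suc k)) ⟩
  0                                   ≡⟨ sym (cong (1 ℕ.*_) (C.k>n⇒nCk≡0 {0} {suc k} (s≤s z≤n))) ⟩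
  1 ℕ.* (0 C suc k)                   ∎
  where open ≡-Reasoning
absorption (suc m) zero    = trans (ℕP.*-identityˡ _) (trans (C.nC1≡n (suc (suc m))) (sym (ℕP.*-identityʳ _)))
absorption (suc m) (suc k) = begin
  k₂ ℕ.* (suc (suc m) C k₂)                         ≡⟨ cong (k₂ ℕ.*_) (sym (C.nCk+nC[k+1]≡[n+1]C[k+1] (suc m) (suc k))) ⟩
  k₂ ℕ.* (A ℕ.+ (suc m C k₂))                       ≡⟨ ℕP.*-distribˡ-+ k₂ A _ ⟩
  k₂ ℕ.* A ℕ.+ k₂ ℕ.* (suc m C k₂)                   ≡⟨ cong (k₂ ℕ.* A ℕ.+_) (absorption m (suc k)) ⟩
  (A ℕ.+ suc k ℕ.* A) ℕ.+ M ℕ.* (m C suc k)        ≡⟨ cong (λ x → (A ℕ.+ x) ℕ.+ M ℕ.* (m C suc k)) (absorption m k) ⟩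
  (A ℕ.+ M ℕ.* (m C k)) ℕ.+ M ℕ.* (m C suc k)      ≡⟨ ℕP.+-assoc A _ _ ⟩
  A ℕ.+ (M ℕ.* (m C k) ℕ.+ M ℕ.* (m C suc k))      ≡⟨ cong (A ℕ.+_) (sym (ℕP.*-distribˡ-+ M (m C k) _)) ⟩
  A ℕ.+ M ℕ.* (m C k ℕ.+ m C suc k)                ≡⟨ cong (λ x → A ℕ.+ M ℕ.* x) (C.nCk+nC[k+1]≡[n+1]C[k+1] m k) ⟩
  A ℕ.+ M ℕ.* A                                   ∎
  where
  open ≡-Reasoning
  k₂ = suc (suc k)
  M = suc m
  A = suc m C suc k

pascalℚ : ∀ r j → binomQ (suc r) (suc j) ≡ binomQ r j + binomQ r (suc j)
pascalℚ r j = trans (cong ℕtoℚ (sym (C.nCk+nC[k+1]≡[n+1]C[k+1] r j))) (ℕtoℚ-+ (r C j) (r C suc j))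

absorptionℚ : ∀ r j → binomQ r j * inv (suc j) ≡ inv (suc r) * binomQ (suc r) (suc j)
absorptionℚ r j = begin
  B * ij                    ≡⟨ sym (trans (cong (_* (B * ij)) (inv*ℕ≡1 r)) (QP.*-identityˡ _)) ⟩
  (ir * Rr) * (B * ij)       ≡⟨ solve 4 (λ  ir Rr B ij → (ir :* Rr) :* (B :* ij) := ir :* ij :* (Rr :* B)) refl  ir Rr B ij ⟩
  ir * ij * (Rr * B)         ≡⟨ cong (ir * ij *_) (sym Jj*B′≡R*B) ⟩
  ir * ij * (Jj * B′)        ≡⟨ solve 4 (λ ir ij Jj B′ → ir :* ij :* (Jj :* B′) := ir :* B′ :* (ij :* Jj)) refl ir ij Jj B′ ⟩
  ir * B′ * (ij * Jj)        ≡⟨ trans (cong (ir * B′ *_) (inv*ℕ≡1 j)) (QP.*-identityʳ _) ⟩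
  ir * B′                   ∎
  where
  open ≡-Reasoning
  B  = binomQ r j
  B′ = binomQ (suc r) (suc j)
  ij = inv (suc j)
  ir = inv (suc r)
  Rr = ℕtoℚ (suc r)
  Jj  = ℕtoℚ (suc j)
  Jj*B′≡R*B : Jj * B′ ≡ Rr * B
  Jj*B′≡R*B = trans (sym (ℕtoℚ-* (suc j) (suc r C suc j)))
             (trans (cong ℕtoℚ (absorption r j)) (ℕtoℚ-* (suc r) (r C j)))

pascal-Σ₀ : ∀ r (φ : ℕ → ℚ) →
  Σ₀ (suc r) (λ k → binomQ (suc r) k * φ k)
    ≡ Σ₀ r (λ k → binomQ r k * φ k) + Σ₀ r (λ j → binomQ r j * φ (suc j))
pascal-Σ₀ r φ = begin
  Σ₀ (suc r) (λ k → binomQ (suc r) k * φ k)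
    ≡⟨ Σ₀-suc r _ ⟩
  1ℚ * φ 0 + Σ₀ r (λ j → binomQ (suc r) (suc j) * φ (suc j))
    ≡⟨ cong (1ℚ * φ 0 +_) (Σ₀-ext r (λ j → trans (cong (_* φ (suc j)) (pascalℚ r j))
                                                  (QP.*-distribʳ-+ (φ (suc j)) (binomQ r j) (binomQ r (suc j))))) ⟩
  1ℚ * φ 0 + Σ₀ r (λ j → binomQ r j * φ (suc j) + binomQ r (suc j) * φ (suc j))
    ≡⟨ cong (1ℚ * φ 0 +_) (Σ₀-+ r _ _) ⟩
  1ℚ * φ 0 + (X + Σ₀ r (λ j → binomQ r (suc j) * φ (suc j)))
    ≡⟨ cong (λ z → 1ℚ * φ 0 + (X + z)) (sym (Σ₁-suc r _)) ⟩
  1ℚ * φ 0 + (X + (Σ₁ r (λ k → binomQ r k * φ k) + binomQ r (suc r) * φ (suc r)))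
    ≡⟨ cong (λ z → 1ℚ * φ 0 + (X + (Σ₁ r (λ k → binomQ r k * φ k) + z))) top-vanishes ⟩
  1ℚ * φ 0 + (X + (Σ₁ r (λ k → binomQ r k * φ k) + 0ℚ))
    ≡⟨ solve 3 (λ a x y → a :+ (x :+ (y :+ con 0ℚ)) := (a :+ y) :+ x) refl (1ℚ * φ 0) X _ ⟩
  (1ℚ * φ 0 + Σ₁ r (λ k → binomQ r k * φ k)) + X
    ≡⟨ cong (_+ X) (sym (Σ₀-split r _)) ⟩
  Σ₀ r (λ k → binomQ r k * φ k) + X ∎
  where
  open ≡-Reasoning
  X = Σ₀ r (λ j → binomQ r j * φ (suc j))
  top-vanishes : binomQ r (suc r) * φ (suc r) ≡ 0ℚ
  top-vanishes = trans (cong (λ z → ℕtoℚ z * φ (suc r)) (C.k>n⇒nCk≡0 (ℕP.n<1+n r))) (QP.*-zeroˡ (φ (suc r)))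

-- Partial fractions for 1/(n·C(n+r,r)) and the binomial transform of ζ*

-- invBinom r m = 1/C(m+r,r), in the product form Π_{i=1}^{r} i/(m+i).
invBinom : ℕ → ℕ → ℚ
invBinom zero    m = 1ℚ
invBinom (suc r) m = invBinom r m * (ℕtoℚ (suc r) * inv (m ℕ.+ suc r))

inv-C≡invBinom : ∀ m r → inv ((m ℕ.+ r) C r) ≡ invBinom r m
inv-C≡invBinom m zero    = refl
inv-C≡invBinom m (suc r) = begin
  inv ((m ℕ.+ suc r) C suc r)     ≡⟨ cong (λ z → inv (z C suc r)) (ℕP.+-suc m r) ⟩
  iB′                             ≡⟨ sym (trans (cong (_* iB′) (ℕ*inv≡1 r)) (QP.*-identityˡ iB′)) ⟩
  (Rr * ir) * iB′                 ≡⟨ QP.*-assoc Rr ir iB′ ⟩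
  Rr * (ir * iB′)                 ≡⟨ cong (Rr *_) absorbed ⟩
  Rr * (iM * iB)                  ≡⟨ solve 3 (λ Rr iM iB → Rr :* (iM :* iB) := iB :* (Rr :* iM)) refl Rr iM iB ⟩
  iB * (Rr * iM)                  ≡⟨ cong₂ (λ x y → x * (Rr * y)) (inv-C≡invBinom m r) (cong inv (sym (ℕP.+-suc m r))) ⟩
  invBinom r m * (Rr * inv (m ℕ.+ suc r)) ∎
  where
  open ≡-Reasoning
  iB′ = inv (suc (m ℕ.+ r) C suc r)
  iB  = inv ((m ℕ.+ r) C r)
  Rr  = ℕtoℚ (suc r)
  ir  = inv (suc r)
  iM  = inv (suc (m ℕ.+ r))
  absorbed : ir * iB′ ≡ iM * iB
  absorbed = trans (sym (inv-* (suc r) (suc (m ℕ.+ r) C suc r)))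
             (trans (cong inv (absorption (m ℕ.+ r) r)) (inv-* (suc (m ℕ.+ r)) ((m ℕ.+ r) C r)))

invBinom-shift : ∀ r m → invBinom r (suc m) * ℕtoℚ (suc m ℕ.+ r) ≡ invBinom r m * ℕtoℚ (suc m)
invBinom-shift zero    m = cong (λ z → 1ℚ * ℕtoℚ z) (ℕP.+-identityʳ (suc m))
invBinom-shift (suc r) m = begin
  (b * (Rr * w)) * W                       ≡⟨ solve 4 (λ a b c d → (a :* (b :* c)) :* d := (a :* b) :* (c :* d)) refl b Rr w W ⟩
  (b * Rr) * (w * W)                       ≡⟨ trans (cong ((b * Rr) *_) (inv*ℕ≡1 (m ℕ.+ suc r))) (QP.*-identityʳ _) ⟩
  b * Rr                                   ≡⟨ sym (trans (cong ((b * Rr) *_) (inv*ℕ≡1 (m ℕ.+ r))) (QP.*-identityʳ _)) ⟩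
  (b * Rr) * (v * V)                       ≡⟨ solve 4 (λ a b c d → (a :* b) :* (c :* d) := (b :* c) :* (a :* d)) refl b Rr v V ⟩
  (Rr * v) * (b * V)                       ≡⟨ cong₂ (λ x y → (Rr * x) * y) (cong inv (sym (ℕP.+-suc m r))) (invBinom-shift r m) ⟩
  (Rr * inv (m ℕ.+ suc r)) * (invBinom r m * ℕtoℚ (suc m))
                                           ≡⟨ solve 4 (λ a b c d → (a :* b) :* (c :* d) := (c :* (a :* b)) :* d) refl Rr (inv (m ℕ.+ suc r)) (invBinom r m) (ℕtoℚ (suc m)) ⟩
  (invBinom r m * (Rr * inv (m ℕ.+ suc r))) * ℕtoℚ (suc m) ∎
  where
  open ≡-Reasoning
  b  = invBinom r (suc m)
  Rr = ℕtoℚ (suc r)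
  w  = inv (suc m ℕ.+ suc r)
  W  = ℕtoℚ (suc m ℕ.+ suc r)
  v  = inv (suc (m ℕ.+ r))
  V  = ℕtoℚ (suc m ℕ.+ r)

invBinom-difference : ∀ r m →
  inv (suc m) * invBinom r (suc m) - inv (suc (suc m)) * invBinom r (suc (suc m))
    ≡ inv (suc m) * invBinom (suc r) (suc m)
invBinom-difference r m = begin
  u * b - u′ * b′              ≡⟨ cong (λ z → u * b - z) u′*b′≡b*w ⟩
  u * b - b * w                ≡⟨ solve 3 (λ a b c → a :* b :- b :* c := b :* (a :- c)) refl u b w ⟩
  b * (u - w)                  ≡⟨ cong (λ z → b * (u - inv z)) (sym (ℕP.+-suc (suc m) r)) ⟩
  b * (u - inv (suc m ℕ.+ suc r)) ≡⟨ cong (b *_) (inv-difference m (suc r)) ⟩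
  b * (Rr * u * inv (suc m ℕ.+ suc r))
                               ≡⟨ solve 4 (λ a b c d → a :* (b :* c :* d) := c :* (a :* (b :* d))) refl b Rr u (inv (suc m ℕ.+ suc r)) ⟩
  u * (b * (Rr * inv (suc m ℕ.+ suc r))) ∎
  where
  open ≡-Reasoning
  u  = inv (suc m)
  u′ = inv (suc (suc m))
  U′ = ℕtoℚ (suc (suc m))
  b  = invBinom r (suc m)
  b′ = invBinom r (suc (suc m))
  w  = inv (suc (suc m) ℕ.+ r)
  W  = ℕtoℚ (suc (suc m) ℕ.+ r)
  Rr = ℕtoℚ (suc r)
  u′*b′≡b*w : u′ * b′ ≡ b * w
  u′*b′≡b*w = begin
    u′ * b′               ≡⟨ sym (trans (cong ((u′ * b′) *_) (ℕ*inv≡1 (suc (m ℕ.+ r)))) (QP.*-identityʳ _)) ⟩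
    (u′ * b′) * (W * w)   ≡⟨ solve 4 (λ a b c d → (a :* b) :* (c :* d) := a :* (b :* c) :* d) refl u′ b′ W w ⟩
    u′ * (b′ * W) * w     ≡⟨ cong (λ z → u′ * z * w) (invBinom-shift r (suc m)) ⟩
    u′ * (b * U′) * w     ≡⟨ solve 4 (λ a b c d → a :* (b :* c) :* d := (a :* c) :* (b :* d)) refl u′ b U′ w ⟩
    (u′ * U′) * (b * w)   ≡⟨ trans (cong (_* (b * w)) (inv*ℕ≡1 (suc m))) (QP.*-identityˡ _) ⟩
    b * w                 ∎

alternating-reciprocal-sum : ∀ r m →
  Σ₀ r (λ j → binomQ r j * (neg1^ j * inv (suc m ℕ.+ j))) ≡ inv (suc m) * invBinom r (suc m)
alternating-reciprocal-sum zero    m = trans (cong (λ z → 0ℚ + 1ℚ * (1ℚ * inv z)) (ℕP.+-identityʳ (suc m)))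
  (solve 1 (λ a → con 0ℚ :+ con 1ℚ :* (con 1ℚ :* a) := a :* con 1ℚ) refl (inv (suc m)))
alternating-reciprocal-sum (suc r) m = begin
  Σ₀ (suc r) (λ k → binomQ (suc r) k * φ k)                 ≡⟨ pascal-Σ₀ r φ ⟩
  Φ + Σ₀ r (λ j → binomQ r j * φ (suc j))                  ≡⟨ cong (Φ +_) (trans (Σ₀-ext r shifted) (Σ₀-neg r _)) ⟩
  Φ - Σ₀ r (λ j → binomQ r j * ψ j)                        ≡⟨ cong₂ _-_ (alternating-reciprocal-sum r m) (alternating-reciprocal-sum r (suc m)) ⟩
  inv (suc m) * invBinom r (suc m) - inv (suc (suc m)) * invBinom r (suc (suc m)) ≡⟨ invBinom-difference r m ⟩
  inv (suc m) * invBinom (suc r) (suc m)                   ∎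
  where
  open ≡-Reasoning
  φ ψ : ℕ → ℚ
  φ j = neg1^ j * inv (suc m ℕ.+ j)
  ψ j = neg1^ j * inv (suc (suc m) ℕ.+ j)
  Φ = Σ₀ r (λ k → binomQ r k * φ k)
  shifted : ∀ j → binomQ r j * φ (suc j) ≡ - (binomQ r j * ψ j)
  shifted j = trans (cong (λ z → binomQ r j * (- neg1^ j * inv z)) (ℕP.+-suc (suc m) j))
    (solve 3 (λ b n i → b :* (:- n :* i) := :- (b :* (n :* i))) refl (binomQ r j) (neg1^ j) (inv (suc (suc m) ℕ.+ j)))

alternating-binomial-sum : ∀ r → Σ₀ (suc r) (λ k → binomQ (suc r) k * neg1^ k) ≡ 0ℚ
alternating-binomial-sum r = begin
  Σ₀ (suc r) (λ k → binomQ (suc r) k * neg1^ k)   ≡⟨ pascal-Σ₀ r neg1^ ⟩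
  X + Σ₀ r (λ j → binomQ r j * neg1^ (suc j))    ≡⟨ cong (X +_) (Σ₀-ext r (λ j → sym (QP.neg-distribʳ-* (binomQ r j) (neg1^ j)))) ⟩
  X + Σ₀ r (λ j → - (binomQ r j * neg1^ j))      ≡⟨ cong (X +_) (Σ₀-neg r _) ⟩
  X - X                                          ≡⟨ QP.+-inverseʳ X ⟩
  0ℚ                                             ∎
  where
  open ≡-Reasoning
  X = Σ₀ r (λ k → binomQ r k * neg1^ k)

alternating-binomial-sum₁ : ∀ r → Σ₁ (suc r) (λ k → binomQ (suc r) k * neg1^ (suc k)) ≡ 1ℚ
alternating-binomial-sum₁ r = begin
  Σ₁ (suc r) (λ k → binomQ (suc r) k * neg1^ (suc k)) ≡⟨ Σ₁-ext (suc r) (λ k → sym (QP.neg-distribʳ-* (binomQ (suc r) k) (neg1^ k))) ⟩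
  Σ₁ (suc r) (λ k → - (binomQ (suc r) k * neg1^ k))   ≡⟨ Σ₁-neg (suc r) _ ⟩
  - X                                                ≡⟨ solve 1 (λ x → :- x := con 1ℚ :- (con 1ℚ :* con 1ℚ :+ x)) refl X ⟩
  1ℚ - (1ℚ * 1ℚ + X)                                  ≡⟨ cong (λ z → 1ℚ - z) (trans (sym (Σ₀-split (suc r) _)) (alternating-binomial-sum r)) ⟩
  1ℚ - 0ℚ                                            ≡⟨ QP.+-identityʳ 1ℚ ⟩
  1ℚ                                                 ∎
  where
  open ≡-Reasoning
  X = Σ₁ (suc r) (λ k → binomQ (suc r) k * neg1^ k)

partial-fractions : ∀ r n →
  inv (suc n) * invBinom (suc r) (suc n)
    ≡ Σ₁ (suc r) (λ k → binomQ (suc r) k * (neg1^ (suc k) * (inv (suc n) - inv (suc n ℕ.+ k))))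
partial-fractions r n = sym (begin
  Σ₁ (suc r) (λ k → binomQ (suc r) k * (neg1^ (suc k) * (u - w k)))  ≡⟨ Σ₁-ext (suc r) expand ⟩
  Σ₁ (suc r) (λ k → c k * u + binomQ (suc r) k * (neg1^ k * w k))   ≡⟨ Σ₁-+ (suc r) _ _ ⟩
  Σ₁ (suc r) (λ k → c k * u) + Y           ≡⟨ cong (_+ Y) (trans (Σ₁-ext (suc r) (λ k → QP.*-comm _ u)) (Σ₁-* (suc r) u c)) ⟩
  u * Σ₁ (suc r) c + Y                     ≡⟨ cong (λ z → u * z + Y) (alternating-binomial-sum₁ r) ⟩
  u * 1ℚ + Y                               ≡⟨ solve 2 (λ u y → u :* con 1ℚ :+ y := (con 1ℚ :* (con 1ℚ :* u) :+ y)) refl u Y ⟩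
  1ℚ * (1ℚ * u) + Y                        ≡⟨ cong (λ z → 1ℚ * (1ℚ * inv z) + Y) (sym (ℕP.+-identityʳ (suc n))) ⟩
  1ℚ * (1ℚ * w 0) + Y                      ≡⟨ sym (Σ₀-split (suc r) _) ⟩
  Σ₀ (suc r) (λ k → binomQ (suc r) k * (neg1^ k * w k)) ≡⟨ alternating-reciprocal-sum (suc r) n ⟩
  u * invBinom (suc r) (suc n)             ∎)
  where
  open ≡-Reasoning
  u = inv (suc n)
  w c : ℕ → ℚ
  w k = inv (suc n ℕ.+ k)
  c k = binomQ (suc r) k * neg1^ (suc k)
  Y = Σ₁ (suc r) (λ k → binomQ (suc r) k * (neg1^ k * w k))
  expand : ∀ k → binomQ (suc r) k * (neg1^ (suc k) * (u - w k)) ≡ c k * u + binomQ (suc r) k * (neg1^ k * w k)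
  expand k = solve 4 (λ b n u w → b :* (:- n :* (u :- w)) := b :* (:- n) :* u :+ b :* (n :* w)) refl
                     (binomQ (suc r) k) (neg1^ k) u (w k)

binomialTransform : ℕ → ℕ → ℚ
binomialTransform a r = Σ₁ r (λ k → binomQ r k * (neg1^ (suc k) * zetaStar k (ones a)))

binomial-transform-ζ* : ∀ a r → binomialTransform a (suc r) ≡ inv (suc r) ^ℚ a
binomial-transform-ζ* zero    r = trans (Σ₁-ext (suc r) (λ k → cong (binomQ (suc r) k *_) (QP.*-identityʳ (neg1^ (suc k)))))
                                        (alternating-binomial-sum₁ r)
binomial-transform-ζ* (suc a) r = begin
  Σ₁ (suc r) F                                     ≡⟨ sym (trans (Σ₀-split (suc r) F) (trans (cong (_+ Σ₁ (suc r) F) φ₀≡0) (QP.+-identityˡ _))) ⟩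
  Σ₀ (suc r) (λ k → binomQ (suc r) k * φ k)        ≡⟨ pascal-Σ₀ r φ ⟩
  X + Σ₀ r (λ j → binomQ r j * φ (suc j))          ≡⟨ cong (X +_) (Σ₀-ext r step) ⟩
  X + Σ₀ r (λ j → - (binomQ r j * φ j) + ir * G (suc j)) ≡⟨ cong (X +_) (Σ₀-+ r _ _) ⟩
  X + (Σ₀ r (λ j → - (binomQ r j * φ j)) + Σ₀ r (λ j → ir * G (suc j)))
                                                   ≡⟨ cong₂ (λ p q → X + (p + q)) (Σ₀-neg r _) (Σ₀-* r ir (λ j → G (suc j))) ⟩
  X + (- X + ir * Σ₀ r (λ j → G (suc j)))          ≡⟨ cong (λ z → X + (- X + ir * z)) (sym (Σ₁-suc r G)) ⟩
  X + (- X + ir * binomialTransform a (suc r))     ≡⟨ solve 2 (λ x y → x :+ (:- x :+ y) := y) refl X (ir * binomialTransform a (suc r)) ⟩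
  ir * binomialTransform a (suc r)                 ≡⟨ cong (ir *_) (binomial-transform-ζ* a r) ⟩
  ir * ir ^ℚ a                                     ∎
  where
  open ≡-Reasoning
  ir = inv (suc r)
  φ G F : ℕ → ℚ
  φ k = neg1^ (suc k) * zetaStar k (ones (suc a))
  F k = binomQ (suc r) k * φ k
  G k = binomQ (suc r) k * (neg1^ (suc k) * zetaStar k (ones a))
  X = Σ₀ r (λ k → binomQ r k * φ k)
  φ₀≡0 : 1ℚ * φ 0 ≡ 0ℚ
  φ₀≡0 = trans (QP.*-identityˡ _) (QP.*-zeroʳ (neg1^ 1))
  -- ζ*_{j+1}({1}_{a+1}) = ζ*_j({1}_{a+1}) + ζ*_{j+1}({1}_a)/(j+1), then absorption.
  step : ∀ j → binomQ r j * φ (suc j) ≡ - (binomQ r j * φ j) + ir * G (suc j)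
  step j = begin
    b * (- n * (z + inv (suc j ^ 1) * y))  ≡⟨ cong (λ x → b * (- n * (z + x * y))) (inv-^1 (suc j)) ⟩
    b * (- n * (z + inv (suc j) * y))      ≡⟨ solve 5 (λ b n z i y → b :* (:- n :* (z :+ i :* y)) := :- (b :* (n :* z)) :+ (b :* i) :* (:- n :* y)) refl b n z (inv (suc j)) y ⟩
    - (b * φ j) + (b * inv (suc j)) * (- n * y)            ≡⟨ cong (λ x → - (b * φ j) + x * (- n * y)) (absorptionℚ r j) ⟩
    - (b * φ j) + (ir * binomQ (suc r) (suc j)) * (- n * y) ≡⟨ cong (- (b * φ j) +_) (QP.*-assoc ir _ _) ⟩
    - (b * φ j) + ir * G (suc j)                           ∎
    where
    b = binomQ r j
    n = neg1^ (suc j)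
    z = zetaStar j (ones (suc a))
    y = zetaStar (suc j) (ones a)

-- The telescoping sum
--   Tel ℓ N k = Σ_{n=1}^{N} ζ_{n-1}({1}_ℓ) (1/n - 1/(n+k)) = ζ*_k({1}_{ℓ+1}) + R_N(ℓ,k)

ζ₁ : ℕ → ℕ → ℚ
ζ₁ ℓ n = zetaN n (ones ℓ)

gap : ℕ → ℕ → ℚ
gap k n = inv n - inv (n ℕ.+ k)

Tel : ℕ → ℕ → ℕ → ℚ
Tel ℓ N k = Σ₁ N (λ n → ζ₁ ℓ (n ∸ 1) * gap k n)

gap-sum : ∀ k N → Σ₁ N (gap k) ≡ H k + (H N - H (N ℕ.+ k))
gap-sum k zero    = solve 1 (λ h → con 0ℚ := h :+ (con 0ℚ :- h)) refl (H k)
gap-sum k (suc N) = trans (cong (_+ gap k (suc N)) (gap-sum k N))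
  (solve 5 (λ hk hn hnk a b → hk :+ (hn :- hnk) :+ (a :- b) := hk :+ ((hn :+ a) :- (hnk :+ b))) refl
           (H k) (H N) (H (N ℕ.+ k)) (inv (suc N)) (inv (suc N ℕ.+ k)))

weighted-gaps : ∀ n k → Σ₁ k (λ j → inv j * gap j (suc n)) ≡ inv (suc n) * (H (suc n ℕ.+ k) - H (suc n))
weighted-gaps n zero    = trans (solve 2 (λ u h → con 0ℚ := u :* (h :- h)) refl (inv (suc n)) (H (suc n)))
                                (cong (λ z → inv (suc n) * (H z - H (suc n))) (sym (ℕP.+-identityʳ (suc n))))
weighted-gaps n (suc k) = begin
  Σ₁ k (λ j → inv j * gap j (suc n)) + inv (suc k) * (u - w) ≡⟨ cong₂ _+_ (weighted-gaps n k) (cong (inv (suc k) *_) (inv-difference n (suc k))) ⟩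
  u * (Hk - H (suc n)) + inv (suc k) * (ℕtoℚ (suc k) * u * w) ≡⟨ cong (u * (Hk - H (suc n)) +_) cancel ⟩
  u * (Hk - H (suc n)) + u * w                   ≡⟨ solve 4 (λ u a b w → u :* (a :- b) :+ u :* w := u :* ((a :+ w) :- b)) refl u Hk (H (suc n)) w ⟩
  u * ((Hk + w) - H (suc n))                     ≡⟨ cong (λ z → u * (z - H (suc n))) (sym H-next) ⟩
  u * (H (suc n ℕ.+ suc k) - H (suc n))          ∎
  where
  open ≡-Reasoning
  u  = inv (suc n)
  w  = inv (suc n ℕ.+ suc k)
  Hk = H (suc n ℕ.+ k)
  cancel : inv (suc k) * (ℕtoℚ (suc k) * u * w) ≡ u * w
  cancel = trans (solve 4 (λ i K u w → i :* (K :* u :* w) := (i :* K) :* (u :* w)) refl (inv (suc k)) (ℕtoℚ (suc k)) u w)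
                 (trans (cong (_* (u * w)) (inv*ℕ≡1 k)) (QP.*-identityˡ _))
  H-next : H (suc n ℕ.+ suc k) ≡ Hk + w
  H-next = trans (cong (λ z → H (suc z)) (ℕP.+-suc n k)) (cong (λ z → Hk + inv (suc z)) (sym (ℕP.+-suc n k)))

-- Summation by parts, using ζ_{n}({1}_{ℓ+1}) = ζ_{n-1}({1}_{ℓ+1}) + ζ_{n-1}({1}_ℓ)/n:
--   Tel (ℓ+1) (M+1) k = ζ_M({1}_{ℓ+1}) (H_{M+1} - H_{M+1+k}) + Σ_{k₁=1}^{k} Tel ℓ M k₁ / k₁
Tel-step : ∀ ℓ k M → Tel (suc ℓ) (suc M) k
  ≡ ζ₁ (suc ℓ) M * (H (suc M) - H (suc M ℕ.+ k)) + Σ₁ k (λ k₁ → inv k₁ * Tel ℓ M k₁)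
Tel-step ℓ k zero = begin
  0ℚ + 0ℚ * gap k 1                ≡⟨ solve 3 (λ x a b → con 0ℚ :+ con 0ℚ :* x := con 0ℚ :* (a :- b) :+ con 0ℚ) refl (gap k 1) (H 1) (H (suc k)) ⟩
  0ℚ * (H 1 - H (suc k)) + 0ℚ      ≡⟨ cong (0ℚ * (H 1 - H (suc k)) +_) (sym (trans (Σ₁-ext k (λ k₁ → QP.*-zeroʳ (inv k₁))) (Σ₁-zero k))) ⟩
  0ℚ * (H 1 - H (suc k)) + Σ₁ k (λ k₁ → inv k₁ * 0ℚ) ∎
  where open ≡-Reasoning
Tel-step ℓ k (suc M) = begin
  Tel (suc ℓ) (suc M) k + ζ₁ (suc ℓ) (suc M) * gap k (suc (suc M))
    ≡⟨ cong₂ _+_ (Tel-step ℓ k M) (cong (λ x → (z + x * y) * gap k (suc (suc M))) (inv-^1 (suc M))) ⟩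
  z * (h₁ - hₖ) + ΣT + (z + a * y) * (p - q)
    ≡⟨ solve 8 (λ z y a h₁ hₖ p q ΣT → z :* (h₁ :- hₖ) :+ ΣT :+ (z :+ a :* y) :* (p :- q)
                  := (z :+ a :* y) :* ((h₁ :+ p) :- (hₖ :+ q)) :+ (ΣT :+ y :* (a :* (hₖ :- h₁)))) refl z y a h₁ hₖ p q ΣT ⟩
  (z + a * y) * ((h₁ + p) - (hₖ + q)) + (ΣT + y * (a * (hₖ - h₁)))
    ≡⟨ cong₂ (λ x w → (z + x * y) * ((h₁ + p) - (hₖ + q)) + (ΣT + y * w)) (sym (inv-^1 (suc M))) (sym (weighted-gaps M k)) ⟩
  boundary + (ΣT + y * Σ₁ k (λ k₁ → inv k₁ * gap k₁ (suc M)))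
    ≡⟨ cong (boundary +_) (sym absorb-new-term) ⟩
  boundary + Σ₁ k (λ k₁ → inv k₁ * Tel ℓ (suc M) k₁) ∎
  where
  open ≡-Reasoning
  z  = ζ₁ (suc ℓ) M
  y  = ζ₁ ℓ M
  a  = inv (suc M)
  h₁ = H (suc M)
  hₖ = H (suc M ℕ.+ k)
  p  = inv (suc (suc M))
  q  = inv (suc (suc M) ℕ.+ k)
  ΣT = Σ₁ k (λ k₁ → inv k₁ * Tel ℓ M k₁)
  boundary = ζ₁ (suc ℓ) (suc M) * (H (suc (suc M)) - H (suc (suc M) ℕ.+ k))
  absorb-new-term : Σ₁ k (λ k₁ → inv k₁ * Tel ℓ (suc M) k₁) ≡ ΣT + y * Σ₁ k (λ k₁ → inv k₁ * gap k₁ (suc M))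
  absorb-new-term = begin
    Σ₁ k (λ k₁ → inv k₁ * (Tel ℓ M k₁ + y * gap k₁ (suc M)))
      ≡⟨ Σ₁-ext k (λ k₁ → solve 4 (λ i t y g → i :* (t :+ y :* g) := i :* t :+ y :* (i :* g)) refl (inv k₁) (Tel ℓ M k₁) y (gap k₁ (suc M))) ⟩
    Σ₁ k (λ k₁ → inv k₁ * Tel ℓ M k₁ + y * (inv k₁ * gap k₁ (suc M)))  ≡⟨ Σ₁-+ k _ _ ⟩
    ΣT + Σ₁ k (λ k₁ → y * (inv k₁ * gap k₁ (suc M)))                  ≡⟨ cong (ΣT +_) (Σ₁-* k y _) ⟩
    ΣT + y * Σ₁ k (λ k₁ → inv k₁ * gap k₁ (suc M))                    ∎

nest-cong : ∀ j k {f g : ℕ → ℚ} → (∀ x → f x ≡ g x) → nest j k f ≡ nest j k g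
nest-cong zero    k f≡g = f≡g k
nest-cong (suc j) k f≡g = Σ₁-ext k (λ k₁ → cong (inv k₁ *_) (nest-cong j k₁ f≡g))

Rterm : ℕ → ℕ → ℕ → ℕ → ℚ
Rterm N ℓ j kⱼ = zetaN (N ∸ 1 ∸ j) (ones (ℓ ∸ j)) * (H (N ∸ j) - H ((N ∸ j) ℕ.+ kⱼ))

-- R obeys the same recursion as Tel (peel off the j = 0 term):
--   R_{M+1}(ℓ+1,k) = ζ_M({1}_{ℓ+1}) (H_{M+1} - H_{M+1+k}) + Σ_{k₁=1}^{k} R_M(ℓ,k₁) / k₁
R-step : ∀ M ℓ k → R (suc M) (suc ℓ) k
  ≡ ζ₁ (suc ℓ) M * (H (suc M) - H (suc M ℕ.+ k)) + Σ₁ k (λ k₁ → inv k₁ * R M ℓ k₁)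
R-step M ℓ k = begin
  R (suc M) (suc ℓ) k
    ≡⟨ Σ₀-suc ℓ (λ j → nest j k (Rterm (suc M) (suc ℓ) j)) ⟩
  r₀ + Σ₀ ℓ (λ j → Σ₁ k (λ k₁ → inv k₁ * nest j k₁ (Rterm (suc M) (suc ℓ) (suc j))))
    ≡⟨ cong (r₀ +_) (Σ₀-ext ℓ (λ j → Σ₁-ext k (λ k₁ → cong (inv k₁ *_) (nest-cong j k₁ (shift j))))) ⟩
  r₀ + Σ₀ ℓ (λ j → Σ₁ k (λ k₁ → inv k₁ * nest j k₁ (Rterm M ℓ j)))
    ≡⟨ cong (r₀ +_) (trans (Σ₀-Σ₁-swap ℓ k _) (Σ₁-ext k (λ k₁ → Σ₀-* ℓ (inv k₁) _))) ⟩
  r₀ + Σ₁ k (λ k₁ → inv k₁ * R M ℓ k₁) ∎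
  where
  open ≡-Reasoning
  r₀ = Rterm (suc M) (suc ℓ) 0 k
  shift : ∀ j x → Rterm (suc M) (suc ℓ) (suc j) x ≡ Rterm M ℓ j x
  shift j x = cong (λ z → zetaN z (ones (ℓ ∸ j)) * (H (M ∸ j) - H ((M ∸ j) ℕ.+ x))) (sym (ℕP.∸-+-assoc M 1 j))

Tel-closed-form : ∀ ℓ N k → ℓ ≤ N → Tel ℓ N k ≡ zetaStar k (ones (suc ℓ)) + R N ℓ k
Tel-closed-form zero N k _ = begin
  Σ₁ N (λ n → 1ℚ * gap k n)          ≡⟨ trans (Σ₁-ext N (λ n → QP.*-identityˡ (gap k n))) (gap-sum k N) ⟩
  H k + (H N - H (N ℕ.+ k))          ≡⟨ cong₂ _+_ (Σ₁-ext k (λ n → sym (trans (QP.*-identityʳ _) (inv-^1 n))))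
                                                 (sym (trans (QP.+-identityˡ _) (QP.*-identityˡ _))) ⟩
  zetaStar k (ones 1) + R N 0 k      ∎
  where open ≡-Reasoning
Tel-closed-form (suc ℓ) (suc M) k (s≤s ℓ≤M) = begin
  Tel (suc ℓ) (suc M) k                                    ≡⟨ Tel-step ℓ k M ⟩
  B + Σ₁ k (λ k₁ → inv k₁ * Tel ℓ M k₁)                    ≡⟨ cong (B +_) (Σ₁-ext k (λ k₁ → cong (inv k₁ *_) (Tel-closed-form ℓ M k₁ ℓ≤M))) ⟩
  B + Σ₁ k (λ k₁ → inv k₁ * (zetaStar k₁ (ones (suc ℓ)) + R M ℓ k₁))
                                                           ≡⟨ cong (B +_) (trans (Σ₁-ext k (λ k₁ → QP.*-distribˡ-+ (inv k₁) _ _)) (Σ₁-+ k _ _)) ⟩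
  B + (Z + ΣR)                                             ≡⟨ solve 3 (λ a b c → a :+ (b :+ c) := b :+ (a :+ c)) refl B Z ΣR ⟩
  Z + (B + ΣR)                                             ≡⟨ cong₂ _+_ (Σ₁-ext k (λ k₁ → cong (_* zetaStar k₁ (ones (suc ℓ))) (sym (inv-^1 k₁))))
                                                                         (sym (R-step M ℓ k)) ⟩
  zetaStar k (ones (suc (suc ℓ))) + R (suc M) (suc ℓ) k    ∎
  where
  open ≡-Reasoning
  B  = ζ₁ (suc ℓ) M * (H (suc M) - H (suc M ℕ.+ k))
  Z  = Σ₁ k (λ k₁ → inv k₁ * zetaStar k₁ (ones (suc ℓ)))
  ΣR = Σ₁ k (λ k₁ → inv k₁ * R M ℓ k₁)

S′ : ℕ → ℕ → ℕ → ℕ → ℚ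
S′ r s ℓ N = Σ₁ N (λ n → ζ₁ ℓ (n ∸ 1) * (invBinom r n * inv n ^ℚ s))

S≡S′ : ∀ r s ℓ N → S r s ℓ N ≡ S′ r s ℓ N
S≡S′ r s ℓ N = Σ₁-ext N (λ n → cong (ζ₁ ℓ (n ∸ 1) *_)
  (trans (inv-* ((n ℕ.+ r) C r) (n ^ s)) (cong₂ _*_ (inv-C≡invBinom n r) (inv-^ n s))))

S′-as-Tel : ∀ r ℓ N → S′ (suc r) 1 ℓ N ≡ Σ₁ (suc r) (λ k → binomQ (suc r) k * neg1^ (suc k) * Tel ℓ N k)
S′-as-Tel r ℓ N = begin
  Σ₁ N (λ n → ζ₁ ℓ (n ∸ 1) * (invBinom (suc r) n * (inv n * 1ℚ)))  ≡⟨ Σ₁-cong N expand ⟩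
  Σ₁ N (λ n → Σ₁ (suc r) (λ k → c k * (ζ₁ ℓ (n ∸ 1) * gap k n)))   ≡⟨ Σ₁-swap N (suc r) _ ⟩
  Σ₁ (suc r) (λ k → Σ₁ N (λ n → c k * (ζ₁ ℓ (n ∸ 1) * gap k n)))   ≡⟨ Σ₁-ext (suc r) (λ k → Σ₁-* N (c k) _) ⟩
  Σ₁ (suc r) (λ k → c k * Tel ℓ N k)                                ∎
  where
  open ≡-Reasoning
  c : ℕ → ℚ
  c k = binomQ (suc r) k * neg1^ (suc k)
  expand : ∀ n → 1 ≤ n → n ≤ N →
    ζ₁ ℓ (n ∸ 1) * (invBinom (suc r) n * (inv n * 1ℚ)) ≡ Σ₁ (suc r) (λ k → c k * (ζ₁ ℓ (n ∸ 1) * gap k n))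
  expand (suc n) _ _ = begin
    z * (invBinom (suc r) (suc n) * (inv (suc n) * 1ℚ))
      ≡⟨ cong (z *_) (trans (solve 2 (λ b i → b :* (i :* con 1ℚ) := i :* b) refl (invBinom (suc r) (suc n)) (inv (suc n)))
                            (partial-fractions r n)) ⟩
    z * Σ₁ (suc r) (λ k → binomQ (suc r) k * (neg1^ (suc k) * gap k (suc n)))
      ≡⟨ sym (Σ₁-* (suc r) z _) ⟩
    Σ₁ (suc r) (λ k → z * (binomQ (suc r) k * (neg1^ (suc k) * gap k (suc n))))
      ≡⟨ Σ₁-ext (suc r) (λ k → solve 4 (λ z b s x → z :* (b :* (s :* x)) := (b :* s) :* (z :* x)) refl
                                        z (binomQ (suc r) k) (neg1^ (suc k)) (gap k (suc n))) ⟩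
    Σ₁ (suc r) (λ k → c k * (z * gap k (suc n))) ∎
    where z = ζ₁ ℓ n

-- The telescoping closed form and the binomial transform of ζ* evaluate it.
S′-base : ∀ r ℓ N → ℓ ≤ N →
  S′ (suc r) 1 ℓ N ≡ inv (suc r) ^ℚ suc ℓ + Σ₁ (suc r) (λ k → binomQ (suc r) k * (neg1^ (suc k) * R N ℓ k))
S′-base r ℓ N ℓ≤N = begin
  S′ (suc r) 1 ℓ N                                                 ≡⟨ S′-as-Tel r ℓ N ⟩
  Σ₁ (suc r) (λ k → b k * s k * Tel ℓ N k)                         ≡⟨ Σ₁-ext (suc r) (λ k → cong (b k * s k *_) (Tel-closed-form ℓ N k ℓ≤N)) ⟩
  Σ₁ (suc r) (λ k → b k * s k * (zetaStar k (ones (suc ℓ)) + R N ℓ k))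
    ≡⟨ trans (Σ₁-ext (suc r) (λ k → solve 4 (λ b s z x → (b :* s) :* (z :+ x) := b :* (s :* z) :+ b :* (s :* x)) refl
                                            (b k) (s k) (zetaStar k (ones (suc ℓ))) (R N ℓ k)))
             (Σ₁-+ (suc r) _ _) ⟩
  binomialTransform (suc ℓ) (suc r) + ΣR                          ≡⟨ cong (_+ ΣR) (binomial-transform-ζ* (suc ℓ) r) ⟩
  inv (suc r) ^ℚ suc ℓ + ΣR                                        ∎
  where
  open ≡-Reasoning
  b s : ℕ → ℚ
  b k = binomQ (suc r) k
  s k = neg1^ (suc k)
  ΣR = Σ₁ (suc r) (λ k → b k * (s k * R N ℓ k))

-- Theorem 2 for r₂ = 1: mainSum is empty, K = 1/r₁^{ℓ+1} and the R-part is E.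
identity-base : ∀ r ℓ N → ℓ ≤ N → S (suc r) 1 ℓ N ≡ mainSum (suc r) 1 ℓ N + K (suc r) 1 ℓ + E (suc r) 1 ℓ N
identity-base r ℓ N ℓ≤N = begin
  S (suc r) 1 ℓ N                          ≡⟨ trans (S≡S′ (suc r) 1 ℓ N) (S′-base r ℓ N ℓ≤N) ⟩
  q + X                                    ≡⟨ solve 2 (λ q x → q :+ x := con 0ℚ :+ q :+ (:- (:- con 1ℚ)) :* x) refl q X ⟩
  0ℚ + q + neg1^ 2 * X                     ≡⟨ cong₂ (λ a b → 0ℚ + a + neg1^ 2 * b) (sym (inv-^ (suc r) (suc ℓ))) (Σ₁-ext (suc r) reassociate) ⟩
  mainSum (suc r) 1 ℓ N + K (suc r) 1 ℓ + E (suc r) 1 ℓ N ∎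
  where
  open ≡-Reasoning
  q = inv (suc r) ^ℚ suc ℓ
  X = Σ₁ (suc r) (λ k → binomQ (suc r) k * (neg1^ (suc k) * R N ℓ k))
  reassociate : ∀ k → binomQ (suc r) k * (neg1^ (suc k) * R N ℓ k) ≡ binomQ (suc r) k * neg1^ (suc k) * inv (k ^ 0) * R N ℓ k
  reassociate k = solve 3 (λ b n x → b :* (n :* x) := b :* n :* con 1ℚ :* x) refl (binomQ (suc r) k) (neg1^ (suc k)) (R N ℓ k)

-- The recursion in r₂: S, mainSum, K and E all satisfy
--   X(r, s+1) = Z - Σ_{k=1}^{r} X(k, s)/k   (Z = ζ_N(s+1,{1}_ℓ) for S and mainSum, 0 for K and E).

-- From invBinom (r+1) n / n = invBinom r n / n - invBinom (r+1) n / (r+1):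
--   S′(r+1, s+1) = S′(r, s+1) - S′(r+1, s)/(r+1).
S′-lower : ∀ r s ℓ N → S′ (suc r) (suc s) ℓ N ≡ S′ r (suc s) ℓ N - inv (suc r) * S′ (suc r) s ℓ N
S′-lower r s ℓ N = trans (Σ₁-cong N termwise) (Σ₁-sub N (inv (suc r)) _ _)
  where
  termwise : ∀ n → 1 ≤ n → n ≤ N →
    ζ₁ ℓ (n ∸ 1) * (invBinom (suc r) n * inv n ^ℚ suc s)
      ≡ ζ₁ ℓ (n ∸ 1) * (invBinom r n * inv n ^ℚ suc s) - inv (suc r) * (ζ₁ ℓ (n ∸ 1) * (invBinom (suc r) n * inv n ^ℚ s))
  termwise (suc n) _ _ = begin
    z * ((b * (Rr * w)) * (u * q))     ≡⟨ solve 6 (λ z b Rr w u q → z :* ((b :* (Rr :* w)) :* (u :* q)) := z :* b :* q :* (Rr :* u :* w)) refl z b Rr w u q ⟩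
    z * b * q * (Rr * u * w)           ≡⟨ cong (z * b * q *_) (sym (inv-difference n (suc r))) ⟩
    z * b * q * (u - w)                ≡⟨ cong (λ x → z * b * q * (u - x)) (sym (trans (cong (_* w) (inv*ℕ≡1 r)) (QP.*-identityˡ w))) ⟩
    z * b * q * (u - (ir * Rr) * w)    ≡⟨ solve 7 (λ z b Rr w u q ir → z :* b :* q :* (u :- (ir :* Rr) :* w)
                                                   := z :* (b :* (u :* q)) :- ir :* (z :* ((b :* (Rr :* w)) :* q))) refl z b Rr w u q ir ⟩
    z * (b * (u * q)) - ir * (z * ((b * (Rr * w)) * q)) ∎
    where
    open ≡-Reasoning
    z  = ζ₁ ℓ n
    b  = invBinom r (suc n)
    Rr = ℕtoℚ (suc r)
    w  = inv (suc n ℕ.+ suc r)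
    u  = inv (suc n)
    q  = inv (suc n) ^ℚ s
    ir = inv (suc r)

-- Iterating S′-lower down to r = 0.
S′-unroll : ∀ r s ℓ N → S′ r (suc s) ℓ N ≡ S′ 0 (suc s) ℓ N - Σ₁ r (λ k → inv k * S′ k s ℓ N)
S′-unroll zero    s ℓ N = solve 1 (λ x → x := x :- con 0ℚ) refl (S′ 0 (suc s) ℓ N)
S′-unroll (suc r) s ℓ N = trans (S′-lower r s ℓ N) (trans (cong (_- inv (suc r) * S′ (suc r) s ℓ N) (S′-unroll r s ℓ N))
  (solve 3 (λ a b c → (a :- b) :- c := a :- (b :+ c)) refl (S′ 0 (suc s) ℓ N) (Σ₁ r (λ k → inv k * S′ k s ℓ N)) (inv (suc r) * S′ (suc r) s ℓ N)))

S′-zero : ∀ s ℓ N → S′ 0 s ℓ N ≡ zetaN N (s ∷ ones ℓ)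
S′-zero s ℓ N = Σ₁-ext N (λ n → trans (QP.*-comm (ζ₁ ℓ (n ∸ 1)) _)
                                       (cong (_* ζ₁ ℓ (n ∸ 1)) (trans (QP.*-identityˡ _) (sym (inv-^ n s)))))

S-recursion : ∀ r t ℓ N → S r (suc (suc t)) ℓ N ≡ zetaN N (suc (suc t) ∷ ones ℓ) - Σ₁ r (λ k → inv k * S k (suc t) ℓ N)
S-recursion r t ℓ N = trans (S≡S′ r (suc (suc t)) ℓ N) (trans (S′-unroll r (suc t) ℓ N)
  (cong₂ _-_ (S′-zero (suc (suc t)) ℓ N) (Σ₁-ext r (λ k → cong (inv k *_) (sym (S≡S′ k (suc t) ℓ N))))))

neg-Σ-inv : ∀ r a (z : ℕ → ℚ) → (- a) * Σ₁ r (λ n → inv (n ^ 1) * z n) ≡ - Σ₁ r (λ k → inv k * (a * z k))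
neg-Σ-inv r a z = trans (sym (Σ₁-* r (- a) _)) (trans (Σ₁-ext r (λ k → trans (cong (λ x → (- a) * (x * z k)) (inv-^1 k))
  (solve 3 (λ a i z → (:- a) :* (i :* z) := :- (i :* (a :* z))) refl a (inv k) (z k)))) (Σ₁-neg r _))

-- Peeling the first argument of ζ*_r({1}_{t+1-i}) gives the recursion for the main sum;
-- the term m = t+2 contributes ζ_N(t+2,{1}_ℓ).
mainSum-recursion : ∀ r t ℓ N → mainSum r (suc (suc t)) ℓ N
  ≡ zetaN N (suc (suc t) ∷ ones ℓ) - Σ₁ r (λ k → inv k * mainSum k (suc t) ℓ N)
mainSum-recursion r t ℓ N = begin
  mainSum r (suc (suc t)) ℓ N                     ≡⟨ Σ₂-shift (suc t) f ⟩
  Σ₁ t (λ i → f (suc i)) + f (suc (suc t))        ≡⟨ cong₂ _+_ (Σ₁-cong t peel) top-term ⟩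
  Σ₁ t (λ i → - Σ₁ r (λ k → inv k * G i k)) + 1ℚ * Z * 1ℚ
    ≡⟨ cong (_+ 1ℚ * Z * 1ℚ) (trans (Σ₁-neg t _) (cong -_ (Σ₁-swap t r _))) ⟩
  - Σ₁ r (λ k → Σ₁ t (λ i → inv k * G i k)) + 1ℚ * Z * 1ℚ
    ≡⟨ cong (λ x → - x + 1ℚ * Z * 1ℚ) (Σ₁-ext r (λ k → trans (Σ₁-* t (inv k) (λ i → G i k)) (cong (inv k *_) (sym (Σ₂-shift t _))))) ⟩
  - ΣM + 1ℚ * Z * 1ℚ                              ≡⟨ solve 2 (λ x z → :- x :+ con 1ℚ :* z :* con 1ℚ := z :- x) refl ΣM Z ⟩
  Z - ΣM                                          ∎
  where
  open ≡-Reasoning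
  f : ℕ → ℚ
  f m = neg1^ (suc (suc t) ∸ m) * zetaN N (m ∷ ones ℓ) * zetaStar r (ones (suc (suc t) ∸ m))
  Z  = zetaN N (suc (suc t) ∷ ones ℓ)
  ΣM = Σ₁ r (λ k → inv k * mainSum k (suc t) ℓ N)
  G : ℕ → ℕ → ℚ
  G i k = neg1^ (t ∸ i) * zetaN N (suc i ∷ ones ℓ) * zetaStar k (ones (t ∸ i))
  top-term : f (suc (suc t)) ≡ 1ℚ * Z * 1ℚ
  top-term = cong (λ x → neg1^ x * Z * zetaStar r (ones x)) (ℕP.n∸n≡0 t)
  peel : ∀ i → 1 ≤ i → i ≤ t → f (suc i) ≡ - Σ₁ r (λ k → inv k * G i k)
  peel i _ i≤t = begin
    f (suc i)                    ≡⟨ cong (λ x → neg1^ x * ζi * zetaStar r (ones x)) (ℕP.+-∸-assoc 1 i≤t) ⟩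
    (- s) * ζi * Σ₁ r (λ n → inv (n ^ 1) * zetaStar n (ones (t ∸ i)))
                                 ≡⟨ cong (_* Σ₁ r (λ n → inv (n ^ 1) * zetaStar n (ones (t ∸ i)))) (sym (QP.neg-distribˡ-* s ζi)) ⟩
    (- (s * ζi)) * Σ₁ r (λ n → inv (n ^ 1) * zetaStar n (ones (t ∸ i)))
                                 ≡⟨ neg-Σ-inv r (s * ζi) (λ n → zetaStar n (ones (t ∸ i))) ⟩
    - Σ₁ r (λ k → inv k * G i k) ∎
    where
    s  = neg1^ (t ∸ i)
    ζi = zetaN N (suc i ∷ ones ℓ)

-- K peels one level of ζ* in the same way (the ζ-term is absent).
K-recursion : ∀ r t ℓ → K r (suc (suc t)) ℓ ≡ - Σ₁ r (λ k → inv k * K k (suc t) ℓ)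
K-recursion r zero ℓ = begin
  neg1^ 3 * Σ₁ r (λ n → inv (n ^ (ℓ ℕ.+ 2)) * 1ℚ)  ≡⟨ cong (neg1^ 3 *_) (Σ₁-ext r split-power) ⟩
  neg1^ 3 * Σ₁ r (λ k → inv k * inv (k ^ suc ℓ))    ≡⟨ solve 1 (λ x → (:- (:- (:- con 1ℚ))) :* x := :- x) refl _ ⟩
  - Σ₁ r (λ k → inv k * inv (k ^ suc ℓ))            ∎
  where
  open ≡-Reasoning
  split-power : ∀ k → inv (k ^ (ℓ ℕ.+ 2)) * 1ℚ ≡ inv k * inv (k ^ suc ℓ)
  split-power k = trans (QP.*-identityʳ _) (trans (cong (λ x → inv (k ^ x)) (ℕP.+-comm ℓ 2)) (inv-* k (k ^ suc ℓ)))
K-recursion r (suc t) ℓ = neg-Σ-inv r (neg1^ (suc (suc (suc t)))) (λ n → zetaStar n (ones t ++ (ℓ ℕ.+ 2 ∷ [])))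

-- Binomial moments of an arbitrary sequence ρ:
--   moment ρ t r = Σ_{k=1}^{r} C(r,k) (-1)^{k+1} ρ k / k^t,
-- satisfy moment ρ (t+1) r = Σ_{k=1}^{r} moment ρ t k / k  (by Pascal and absorption).
module BinomialMoments (ρ : ℕ → ℚ) where

  moment : ℕ → ℕ → ℚ
  moment t r = Σ₁ r (λ k → binomQ r k * neg1^ (suc k) * inv (k ^ t) * ρ k)

  weight : ℕ → ℕ → ℚ
  weight t k = neg1^ (suc k) * inv (k ^ t) * ρ k

  moment-as-Σ₁ : ∀ t r → moment t r ≡ Σ₁ r (λ k → binomQ r k * weight t k)
  moment-as-Σ₁ t r = Σ₁-ext r (λ k → solve 4 (λ b n i x → b :* n :* i :* x := b :* (n :* i :* x)) refl
                                               (binomQ r k) (neg1^ (suc k)) (inv (k ^ t)) (ρ k))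

  -- For t ≥ 1 the k = 0 term vanishes (inv 0 = 0), so the sum may start at 0.
  moment-as-Σ₀ : ∀ t r → moment (suc t) r ≡ Σ₀ r (λ k → binomQ r k * weight (suc t) k)
  moment-as-Σ₀ t r = begin
    moment (suc t) r            ≡⟨ moment-as-Σ₁ (suc t) r ⟩
    Σ₁ r F                      ≡⟨ sym (trans (Σ₀-split r F) (trans (cong (_+ Σ₁ r F) zero-term) (QP.+-identityˡ _))) ⟩
    Σ₀ r F                      ∎
    where
    open ≡-Reasoning
    F : ℕ → ℚ
    F k = binomQ r k * weight (suc t) k
    zero-term : F 0 ≡ 0ℚ
    zero-term = trans (cong (binomQ r 0 *_) (trans (cong (_* ρ 0) (QP.*-zeroʳ (neg1^ 1))) (QP.*-zeroˡ (ρ 0))))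
                      (QP.*-zeroʳ (binomQ r 0))

  moment-step : ∀ t r → moment (suc t) (suc r) ≡ moment (suc t) r + inv (suc r) * moment t (suc r)
  moment-step t r = begin
    moment (suc t) (suc r)                                         ≡⟨ moment-as-Σ₀ t (suc r) ⟩
    Σ₀ (suc r) (λ k → binomQ (suc r) k * weight (suc t) k)         ≡⟨ pascal-Σ₀ r (weight (suc t)) ⟩
    Σ₀ r (λ k → binomQ r k * weight (suc t) k) + Σ₀ r (λ j → binomQ r j * weight (suc t) (suc j))
                                                                   ≡⟨ cong₂ _+_ (sym (moment-as-Σ₀ t r)) (Σ₀-ext r absorb) ⟩
    moment (suc t) r + Σ₀ r (λ j → ir * (binomQ (suc r) (suc j) * weight t (suc j)))
                                                                   ≡⟨ cong (moment (suc t) r +_) (Σ₀-* r ir _) ⟩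
    moment (suc t) r + ir * Σ₀ r (λ j → binomQ (suc r) (suc j) * weight t (suc j))
                                                                   ≡⟨ cong (λ x → moment (suc t) r + ir * x) (sym (trans (moment-as-Σ₁ t (suc r)) (Σ₁-suc r _))) ⟩
    moment (suc t) r + ir * moment t (suc r)                       ∎
    where
    open ≡-Reasoning
    ir = inv (suc r)
    absorb : ∀ j → binomQ r j * weight (suc t) (suc j) ≡ ir * (binomQ (suc r) (suc j) * weight t (suc j))
    absorb j = begin
      b * (n * inv (suc j ^ suc t) * x)             ≡⟨ cong (λ y → b * (n * y * x)) (inv-* (suc j) (suc j ^ t)) ⟩
      b * (n * (inv (suc j) * inv (suc j ^ t)) * x) ≡⟨ solve 5 (λ b n i i′ x → b :* (n :* (i :* i′) :* x) := (b :* i) :* (n :* i′ :* x)) refl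
                                                               b n (inv (suc j)) (inv (suc j ^ t)) x ⟩
      (b * inv (suc j)) * weight t (suc j)          ≡⟨ cong (_* weight t (suc j)) (absorptionℚ r j) ⟩
      (ir * binomQ (suc r) (suc j)) * weight t (suc j) ≡⟨ QP.*-assoc ir _ _ ⟩
      ir * (binomQ (suc r) (suc j) * weight t (suc j)) ∎
      where
      b = binomQ r j
      n = neg1^ (suc (suc j))
      x = ρ (suc j)

  moment-recursion : ∀ t r → moment (suc t) r ≡ Σ₁ r (λ k → inv k * moment t k)
  moment-recursion t zero    = refl
  moment-recursion t (suc r) = trans (moment-step t r) (cong (_+ inv (suc r) * moment t (suc r)) (moment-recursion t r))

-- E is (-1)^{r₂+1} times the binomial moment of order r₂-1 of k ↦ R_N(ℓ,k).
E-recursion : ∀ r t ℓ N → E r (suc (suc t)) ℓ N ≡ - Σ₁ r (λ k → inv k * E k (suc t) ℓ N)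
E-recursion r t ℓ N = begin
  (- a) * moment (suc t) r                  ≡⟨ cong ((- a) *_) (moment-recursion t r) ⟩
  (- a) * Σ₁ r (λ k → inv k * moment t k)   ≡⟨ sym (QP.neg-distribˡ-* a _) ⟩
  - (a * Σ₁ r (λ k → inv k * moment t k))   ≡⟨ cong -_ (sym (Σ₁-* r a _)) ⟩
  - Σ₁ r (λ k → a * (inv k * moment t k))   ≡⟨ cong -_ (Σ₁-ext r (λ k → solve 3 (λ a i b → a :* (i :* b) := i :* (a :* b)) refl a (inv k) (moment t k))) ⟩
  - Σ₁ r (λ k → inv k * (a * moment t k))   ∎
  where
  open ≡-Reasoning
  open BinomialMoments (R N ℓ)
  a = neg1^ (suc (suc t))

identity : ∀ t r ℓ N → ℓ ≤ N →
  S (suc r) (suc t) ℓ N ≡ mainSum (suc r) (suc t) ℓ N + K (suc r) (suc t) ℓ + E (suc r) (suc t) ℓ N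
identity zero    r ℓ N ℓ≤N = identity-base r ℓ N ℓ≤N
identity (suc t) r ℓ N ℓ≤N = begin
  S (suc r) (suc (suc t)) ℓ N                             ≡⟨ S-recursion (suc r) t ℓ N ⟩
  Z - Σ₁ (suc r) (λ k → inv k * S k (suc t) ℓ N)          ≡⟨ cong (λ x → Z - x) (Σ₁-cong (suc r) induction-hypothesis) ⟩
  Z - Σ₁ (suc r) (λ k → inv k * M k + inv k * Kt k + inv k * Et k)
                                                          ≡⟨ cong (λ x → Z - x) (trans (Σ₁-+ (suc r) _ _) (cong (_+ ΣE) (Σ₁-+ (suc r) _ _))) ⟩
  Z - (ΣM + ΣK + ΣE)                                      ≡⟨ solve 4 (λ z m k e → z :- (m :+ k :+ e) := (z :- m) :+ (:- k) :+ (:- e)) refl Z ΣM ΣK ΣE ⟩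
  (Z - ΣM) + (- ΣK) + (- ΣE)                              ≡⟨ sym (cong₂ _+_ (cong₂ _+_ (mainSum-recursion (suc r) t ℓ N) (K-recursion (suc r) t ℓ))
                                                                             (E-recursion (suc r) t ℓ N)) ⟩
  mainSum (suc r) (suc (suc t)) ℓ N + K (suc r) (suc (suc t)) ℓ + E (suc r) (suc (suc t)) ℓ N ∎
  where
  open ≡-Reasoning
  M Kt Et : ℕ → ℚ
  M k  = mainSum k (suc t) ℓ N
  Kt k = K k (suc t) ℓ
  Et k = E k (suc t) ℓ N
  Z  = zetaN N (suc (suc t) ∷ ones ℓ)
  ΣM = Σ₁ (suc r) (λ k → inv k * M k)
  ΣK = Σ₁ (suc r) (λ k → inv k * Kt k)
  ΣE = Σ₁ (suc r) (λ k → inv k * Et k)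
  induction-hypothesis : ∀ k → 1 ≤ k → k ≤ suc r → inv k * S k (suc t) ℓ N ≡ inv k * M k + inv k * Kt k + inv k * Et k
  induction-hypothesis (suc k) _ _ = trans (cong (inv (suc k) *_) (identity t k ℓ N ℓ≤N))
    (solve 4 (λ i a b c → i :* (a :+ b :+ c) := i :* a :+ i :* b :+ i :* c) refl (inv (suc k)) _ _ _)

*-monoˡ-nonneg : ∀ c {a b} → 0ℚ ≤ℚ c → a ≤ℚ b → c * a ≤ℚ c * b
*-monoˡ-nonneg c 0≤c a≤b = QP.*-monoˡ-≤-nonNeg c {{Q.nonNegative 0≤c}} a≤b

*-monoʳ-nonneg : ∀ c {a b} → 0ℚ ≤ℚ c → a ≤ℚ b → a * c ≤ℚ b * c
*-monoʳ-nonneg c 0≤c a≤b = QP.*-monoʳ-≤-nonNeg c {{Q.nonNegative 0≤c}} a≤b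

*-mono-nonneg : ∀ {a b c e} → 0ℚ ≤ℚ a → 0ℚ ≤ℚ c → a ≤ℚ b → c ≤ℚ e → a * c ≤ℚ b * e
*-mono-nonneg {a} {b} {c} 0≤a 0≤c a≤b c≤e = QP.≤-trans (*-monoʳ-nonneg c 0≤c a≤b) (*-monoˡ-nonneg b (QP.≤-trans 0≤a a≤b) c≤e)

0≤* : ∀ {a b} → 0ℚ ≤ℚ a → 0ℚ ≤ℚ b → 0ℚ ≤ℚ a * b
0≤* {a} 0≤a 0≤b = QP.≤-trans (QP.≤-reflexive (sym (QP.*-zeroʳ a))) (*-monoˡ-nonneg a 0≤a 0≤b)

x≤x+ : ∀ x {y} → 0ℚ ≤ℚ y → x ≤ℚ x + y
x≤x+ x 0≤y = QP.≤-trans (QP.≤-reflexive (sym (QP.+-identityʳ x))) (QP.+-monoʳ-≤ x 0≤y)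

0<1 : 0ℚ < 1ℚ
0<1 = Q.*<* (ℤ.+<+ (s≤s z≤n))

0≤ℕtoℚ : ∀ n → 0ℚ ≤ℚ ℕtoℚ n
0≤ℕtoℚ n = QP.nonNegative⁻¹ _ {{QP.normalize-nonNeg n 1}}

0<inv : ∀ n → 0ℚ < inv (suc n)
0<inv n = QP.positive⁻¹ _ {{QP.normalize-pos 1 (suc n)}}

0≤inv : ∀ n → 0ℚ ≤ℚ inv n
0≤inv zero    = QP.≤-refl
0≤inv (suc n) = QP.<⇒≤ (0<inv n)

ℕtoℚ-mono : ∀ {m n} → m ≤ n → ℕtoℚ m ≤ℚ ℕtoℚ n
ℕtoℚ-mono {m} {n} m≤n = QP.≤-trans (x≤x+ (ℕtoℚ m) (0≤ℕtoℚ (n ∸ m)))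
  (QP.≤-reflexive (trans (sym (ℕtoℚ-+ m (n ∸ m))) (cong ℕtoℚ (ℕP.m+[n∸m]≡n m≤n))))

1≤ℕtoℚ-suc : ∀ n → 1ℚ ≤ℚ ℕtoℚ (suc n)
1≤ℕtoℚ-suc n = ℕtoℚ-mono {1} {suc n} (s≤s z≤n)

inv-antimono : ∀ {m n} → m ≤ n → inv (suc n) ≤ℚ inv (suc m)
inv-antimono {m} {n} m≤n = begin
  inv (suc n)                                   ≡⟨ sym (trans (cong (inv (suc n) *_) (ℕ*inv≡1 m)) (QP.*-identityʳ (inv (suc n)))) ⟩
  inv (suc n) * (ℕtoℚ (suc m) * inv (suc m))    ≡⟨ sym (QP.*-assoc (inv (suc n)) (ℕtoℚ (suc m)) (inv (suc m))) ⟩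
  (inv (suc n) * ℕtoℚ (suc m)) * inv (suc m)    ≤⟨ *-monoʳ-nonneg (inv (suc m)) (0≤inv (suc m))
                                                     (*-monoˡ-nonneg (inv (suc n)) (0≤inv (suc n)) (ℕtoℚ-mono (s≤s m≤n))) ⟩
  (inv (suc n) * ℕtoℚ (suc n)) * inv (suc m)    ≡⟨ trans (cong (_* inv (suc m)) (inv*ℕ≡1 n)) (QP.*-identityˡ (inv (suc m))) ⟩
  inv (suc m)                                   ∎
  where open QP.≤-Reasoning

monotone-by-steps : ∀ (f : ℕ → ℚ) → (∀ n → f n ≤ℚ f (suc n)) → ∀ {m n} → m ≤ n → f m ≤ℚ f n
monotone-by-steps f step {m} m≤n = subst (λ z → f m ≤ℚ f z) (ℕP.m+[n∸m]≡n m≤n) (ascend m _)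
  where
  ascend : ∀ m k → f m ≤ℚ f (m ℕ.+ k)
  ascend m zero    = QP.≤-reflexive (cong f (sym (ℕP.+-identityʳ m)))
  ascend m (suc k) = QP.≤-trans (ascend m k) (QP.≤-trans (step (m ℕ.+ k)) (QP.≤-reflexive (cong f (sym (ℕP.+-suc m k)))))

^ℚ-nonneg : ∀ {x} a → 0ℚ ≤ℚ x → 0ℚ ≤ℚ x ^ℚ a
^ℚ-nonneg zero    0≤x = QP.<⇒≤ 0<1
^ℚ-nonneg (suc a) 0≤x = 0≤* 0≤x (^ℚ-nonneg a 0≤x)

^ℚ-mono : ∀ {x y} a → 0ℚ ≤ℚ x → x ≤ℚ y → x ^ℚ a ≤ℚ y ^ℚ a
^ℚ-mono zero    0≤x x≤y = QP.≤-refl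
^ℚ-mono (suc a) 0≤x x≤y = *-mono-nonneg 0≤x (^ℚ-nonneg a 0≤x) x≤y (^ℚ-mono a 0≤x x≤y)

^ℚ-+ : ∀ x m n → x ^ℚ (m ℕ.+ n) ≡ x ^ℚ m * x ^ℚ n
^ℚ-+ x zero    n = sym (QP.*-identityˡ (x ^ℚ n))
^ℚ-+ x (suc m) n = trans (cong (x *_) (^ℚ-+ x m n)) (sym (QP.*-assoc x (x ^ℚ m) (x ^ℚ n)))

Tends0 : (ℕ → ℚ) → Set
Tends0 f = ∀ ε → 0ℚ < ε → ∃ λ N₀ → ∀ N → N₀ ≤ N → ∣ f N ∣ < ε

tends0-zero : Tends0 (λ _ → 0ℚ)
tends0-zero ε 0<ε = 0 , λ _ _ → 0<ε

½ : ℚ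
½ = ℤ.+ 1 / 2

0<½* : ∀ {ε} → 0ℚ < ε → 0ℚ < ½ * ε
0<½* 0<ε = QP.≤-<-trans (QP.≤-reflexive (sym (QP.*-zeroʳ ½))) (QP.*-monoʳ-<-pos ½ 0<ε)

½*+½* : ∀ ε → ½ * ε + ½ * ε ≡ ε
½*+½* ε = trans (sym (QP.*-distribʳ-+ ε ½ ½)) (QP.*-identityˡ ε)

tends0-+ : ∀ {f g : ℕ → ℚ} → Tends0 f → Tends0 g → Tends0 (λ N → f N + g N)
tends0-+ {f} {g} f→0 g→0 ε 0<ε with f→0 (½ * ε) (0<½* 0<ε) | g→0 (½ * ε) (0<½* 0<ε)
... | N₁ , small-f | N₂ , small-g = N₁ ℕ.⊔ N₂ , λ N N₁⊔N₂≤N → begin-strict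
  ∣ f N + g N ∣       ≤⟨ QP.∣p+q∣≤∣p∣+∣q∣ (f N) (g N) ⟩
  ∣ f N ∣ + ∣ g N ∣   <⟨ QP.+-mono-< (small-f N (ℕP.≤-trans (ℕP.m≤m⊔n N₁ N₂) N₁⊔N₂≤N))
                                     (small-g N (ℕP.≤-trans (ℕP.m≤n⊔m N₁ N₂) N₁⊔N₂≤N)) ⟩
  ½ * ε + ½ * ε       ≡⟨ ½*+½* ε ⟩
  ε                   ∎
  where open QP.≤-Reasoning

tends0-scale : ∀ c {f : ℕ → ℚ} → Tends0 f → Tends0 (λ N → c * f N)
tends0-scale c {f} f→0 ε 0<ε = proj₁ small , λ N N₀≤N → begin-strict
  ∣ c * f N ∣           ≡⟨ QP.∣p*q∣≡∣p∣*∣q∣ c (f N) ⟩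
  ∣ c ∣ * ∣ f N ∣       ≤⟨ *-monoʳ-nonneg ∣ f N ∣ (QP.0≤∣p∣ (f N)) (x≤x+ ∣ c ∣ (QP.<⇒≤ 0<1)) ⟩
  c′ * ∣ f N ∣          <⟨ QP.*-monoʳ-<-pos c′ {{c′-pos}} (proj₂ small N N₀≤N) ⟩
  c′ * (ε * c′⁻¹)       ≡⟨ solve 3 (λ a e i → a :* (e :* i) := e :* (a :* i)) refl c′ ε c′⁻¹ ⟩
  ε * (c′ * c′⁻¹)       ≡⟨ trans (cong (ε *_) (QP.*-inverseʳ c′ {{c′-nonzero}})) (QP.*-identityʳ ε) ⟩
  ε                     ∎
  where
  open QP.≤-Reasoning
  -- scale by c′ = |c| + 1 > 0 rather than |c|, which may vanish
  c′ = ∣ c ∣ + 1ℚ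
  c′-pos : Q.Positive c′
  c′-pos = Q.positive (QP.≤-<-trans (QP.0≤∣p∣ c)
    (QP.≤-<-trans (QP.≤-reflexive (sym (QP.+-identityʳ ∣ c ∣))) (QP.+-monoʳ-< ∣ c ∣ 0<1)))
  c′-nonzero : Q.NonZero c′
  c′-nonzero = QP.pos⇒nonZero c′ {{c′-pos}}
  c′⁻¹ : ℚ
  c′⁻¹ = (Q.1/ c′) {{c′-nonzero}}
  small = f→0 (ε * c′⁻¹) (QP.≤-<-trans (QP.≤-reflexive (sym (QP.*-zeroˡ c′⁻¹)))
                                      (QP.*-monoˡ-<-pos c′⁻¹ {{QP.1/pos⇒pos c′ {{c′-pos}}}} 0<ε))

tends0-dominated : ∀ {f g : ℕ → ℚ} → (∀ N → ∣ f N ∣ ≤ℚ g N) → Tends0 g → Tends0 f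
tends0-dominated {f} f≤g g→0 ε 0<ε with g→0 ε 0<ε
... | N₀ , small = N₀ , λ N N₀≤N → QP.≤-<-trans (f≤g N)
  (subst (_< ε) (QP.0≤p⇒∣p∣≡p (QP.≤-trans (QP.0≤∣p∣ (f N)) (f≤g N))) (small N N₀≤N))

tends0-shift : ∀ j {f : ℕ → ℚ} → Tends0 f → Tends0 (λ N → f (N ∸ j))
tends0-shift j f→0 ε 0<ε with f→0 ε 0<ε
... | N₀ , small = N₀ ℕ.+ j , λ N N₀+j≤N → small (N ∸ j) (subst (_≤ N ∸ j) (ℕP.m+n∸n≡m N₀ j) (ℕP.∸-monoˡ-≤ j N₀+j≤N))

tends0-Σ₁ : ∀ n (F : ℕ → ℕ → ℚ) → (∀ k → Tends0 (F k)) → Tends0 (λ N → Σ₁ n (λ k → F k N))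
tends0-Σ₁ zero    F F→0 = tends0-zero
tends0-Σ₁ (suc n) F F→0 = tends0-+ (tends0-Σ₁ n F F→0) (F→0 (suc n))

tends0-Σ₀ : ∀ n (F : ℕ → ℕ → ℚ) → (∀ k → Tends0 (F k)) → Tends0 (λ N → Σ₀ n (λ k → F k N))
tends0-Σ₀ zero    F F→0 = tends0-+ tends0-zero (F→0 0)
tends0-Σ₀ (suc n) F F→0 = tends0-+ (tends0-Σ₀ n F F→0) (F→0 (suc n))

tends0-nest : ∀ j k (G : ℕ → ℕ → ℚ) → (∀ κ → Tends0 (λ N → G N κ)) → Tends0 (λ N → nest j k (G N))
tends0-nest zero    k G G→0 = G→0 k
tends0-nest (suc j) k G G→0 = tends0-Σ₁ k (λ k₁ N → inv k₁ * nest j k₁ (G N)) (λ k₁ → tends0-scale (inv k₁) (tends0-nest j k₁ G G→0))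

0≤H : ∀ n → 0ℚ ≤ℚ H n
0≤H zero    = QP.≤-refl
0≤H (suc n) = QP.+-mono-≤ (0≤H n) (0≤inv (suc n))

H-step : ∀ n → H n ≤ℚ H (suc n)
H-step n = x≤x+ (H n) (0≤inv (suc n))

ζ₁-nonneg : ∀ a n → 0ℚ ≤ℚ ζ₁ a n
ζ₁-nonneg zero    n       = QP.<⇒≤ 0<1
ζ₁-nonneg (suc a) zero    = QP.≤-refl
ζ₁-nonneg (suc a) (suc n) = QP.+-mono-≤ (ζ₁-nonneg (suc a) n) (0≤* (0≤inv (suc n ^ 1)) (ζ₁-nonneg a n))

ζ₁-step : ∀ a n → ζ₁ a n ≤ℚ ζ₁ a (suc n)
ζ₁-step zero    n = QP.≤-refl
ζ₁-step (suc a) n = x≤x+ (ζ₁ (suc a) n) (0≤* (0≤inv (suc n ^ 1)) (ζ₁-nonneg a n))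

ζ₁≤H^ : ∀ a n → ζ₁ a n ≤ℚ H n ^ℚ a
ζ₁≤H^ zero    n       = QP.≤-refl
ζ₁≤H^ (suc a) zero    = QP.≤-reflexive (sym (QP.*-zeroˡ (0ℚ ^ℚ a)))
ζ₁≤H^ (suc a) (suc n) = begin
  ζ₁ (suc a) n + inv (suc n ^ 1) * ζ₁ a n    ≤⟨ QP.+-mono-≤ (ζ₁≤H^ (suc a) n) (*-monoˡ-nonneg (inv (suc n ^ 1)) (0≤inv (suc n ^ 1)) (ζ₁≤H^ a n)) ⟩
  H n * h + inv (suc n ^ 1) * h              ≡⟨ cong (λ z → H n * h + z * h) (inv-^1 (suc n)) ⟩
  H n * h + inv (suc n) * h                  ≡⟨ sym (QP.*-distribʳ-+ h (H n) (inv (suc n))) ⟩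
  H (suc n) * h                              ≤⟨ *-monoˡ-nonneg (H (suc n)) (0≤H (suc n)) (^ℚ-mono a (0≤H n) (H-step n)) ⟩
  H (suc n) * H (suc n) ^ℚ a                 ∎
  where
  open QP.≤-Reasoning
  h = H n ^ℚ a

H-gap-nonneg : ∀ M κ → 0ℚ ≤ℚ H (M ℕ.+ κ) - H M
H-gap-nonneg M κ = QP.≤-trans (QP.≤-reflexive (sym (QP.+-inverseʳ (H M))))
  (QP.+-monoˡ-≤ (- H M) (monotone-by-steps H H-step (ℕP.m≤m+n M κ)))

H-gap-bound : ∀ M κ → H (M ℕ.+ κ) - H M ≤ℚ ℕtoℚ κ * inv (suc M)
H-gap-bound M zero = QP.≤-reflexive (trans (cong (λ z → H z - H M) (ℕP.+-identityʳ M))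
  (trans (QP.+-inverseʳ (H M)) (sym (QP.*-zeroˡ (inv (suc M))))))
H-gap-bound M (suc κ) = begin
  H (M ℕ.+ suc κ) - H M                      ≡⟨ cong (λ z → H z - H M) (ℕP.+-suc M κ) ⟩
  H (suc (M ℕ.+ κ)) - H M                    ≡⟨ solve 3 (λ a b c → (a :+ b) :- c := (a :- c) :+ b) refl (H (M ℕ.+ κ)) (inv (suc (M ℕ.+ κ))) (H M) ⟩
  (H (M ℕ.+ κ) - H M) + inv (suc (M ℕ.+ κ))  ≤⟨ QP.+-mono-≤ (H-gap-bound M κ) (inv-antimono (ℕP.m≤m+n M κ)) ⟩
  ℕtoℚ κ * inv (suc M) + inv (suc M)         ≡⟨ solve 2 (λ k i → k :* i :+ i := (con 1ℚ :+ k) :* i) refl (ℕtoℚ κ) (inv (suc M)) ⟩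
  (1ℚ + ℕtoℚ κ) * inv (suc M)                ≡⟨ cong (_* inv (suc M)) (sym (ℕtoℚ-suc κ)) ⟩
  ℕtoℚ (suc κ) * inv (suc M)                 ∎
  where open QP.≤-Reasoning

∣H-gap∣-bound : ∀ M κ → ∣ H M - H (M ℕ.+ κ) ∣ ≤ℚ ℕtoℚ κ * inv (suc M)
∣H-gap∣-bound M κ = begin
  ∣ H M - H (M ℕ.+ κ) ∣      ≡⟨ cong ∣_∣ (solve 2 (λ a b → a :- b := :- (b :- a)) refl (H M) (H (M ℕ.+ κ))) ⟩
  ∣ - (H (M ℕ.+ κ) - H M) ∣  ≡⟨ trans (QP.∣-p∣≡∣p∣ _) (QP.0≤p⇒∣p∣≡p (H-gap-nonneg M κ)) ⟩
  H (M ℕ.+ κ) - H M          ≤⟨ H-gap-bound M κ ⟩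
  ℕtoℚ κ * inv (suc M)       ∎
  where open QP.≤-Reasoning

decay : ℕ → ℕ → ℚ
decay a M = H M ^ℚ a * inv (suc M)

Rterm-bound : ∀ N ℓ j κ → ∣ Rterm N ℓ j κ ∣ ≤ℚ ℕtoℚ κ * decay (ℓ ∸ j) (N ∸ j)
Rterm-bound N ℓ j κ = begin
  ∣ z * (H M - H (M ℕ.+ κ)) ∣        ≡⟨ QP.∣p*q∣≡∣p∣*∣q∣ z _ ⟩
  ∣ z ∣ * ∣ H M - H (M ℕ.+ κ) ∣      ≡⟨ cong (_* ∣ H M - H (M ℕ.+ κ) ∣) (QP.0≤p⇒∣p∣≡p (ζ₁-nonneg a (N ∸ 1 ∸ j))) ⟩
  z * ∣ H M - H (M ℕ.+ κ) ∣          ≤⟨ *-mono-nonneg (ζ₁-nonneg a (N ∸ 1 ∸ j)) (QP.0≤∣p∣ _) z≤H^a (∣H-gap∣-bound M κ) ⟩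
  H M ^ℚ a * (ℕtoℚ κ * inv (suc M))  ≡⟨ solve 3 (λ q k i → q :* (k :* i) := k :* (q :* i)) refl (H M ^ℚ a) (ℕtoℚ κ) (inv (suc M)) ⟩
  ℕtoℚ κ * decay a M                 ∎
  where
  open QP.≤-Reasoning
  M = N ∸ j
  a = ℓ ∸ j
  z = ζ₁ a (N ∸ 1 ∸ j)
  N∸1∸j≡M∸1 : N ∸ 1 ∸ j ≡ M ∸ 1
  N∸1∸j≡M∸1 = trans (ℕP.∸-+-assoc N 1 j) (trans (cong (N ∸_) (ℕP.+-comm 1 j)) (sym (ℕP.∸-+-assoc N j 1)))
  z≤H^a : z ≤ℚ H M ^ℚ a
  z≤H^a = QP.≤-trans (QP.≤-reflexive (cong (ζ₁ a) N∸1∸j≡M∸1))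
          (QP.≤-trans (monotone-by-steps (ζ₁ a) (ζ₁-step a) (ℕP.m∸n≤m M 1)) (ζ₁≤H^ a M))

power-difference-bound : ∀ b x y → 0ℚ ≤ℚ y → y ≤ℚ x → x ^ℚ suc b - y ^ℚ suc b ≤ℚ ℕtoℚ (suc b) * (x - y) * x ^ℚ b
power-difference-bound zero x y _ _ = QP.≤-reflexive (solve 2 (λ x y → x :* con 1ℚ :- y :* con 1ℚ := con 1ℚ :* (x :- y) :* con 1ℚ) refl x y)
power-difference-bound (suc b) x y 0≤y y≤x = begin
  x ^ℚ suc (suc b) - y ^ℚ suc (suc b)  ≡⟨ solve 4 (λ x y p q → x :* p :- y :* q := (x :- y) :* p :+ y :* (p :- q)) refl x y X (y ^ℚ suc b) ⟩
  (x - y) * X + y * (X - y ^ℚ suc b)   ≤⟨ QP.+-monoʳ-≤ ((x - y) * X) (*-monoˡ-nonneg y 0≤y (power-difference-bound b x y 0≤y y≤x)) ⟩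
  (x - y) * X + y * W                  ≤⟨ QP.+-monoʳ-≤ ((x - y) * X) (*-monoʳ-nonneg W 0≤W y≤x) ⟩
  (x - y) * X + x * W                  ≡⟨ solve 4 (λ x y k p → (x :- y) :* (x :* p) :+ x :* (k :* (x :- y) :* p) := (con 1ℚ :+ k) :* (x :- y) :* (x :* p)) refl
                                                 x y (ℕtoℚ (suc b)) (x ^ℚ b) ⟩
  (1ℚ + ℕtoℚ (suc b)) * (x - y) * X    ≡⟨ cong (λ z → z * (x - y) * X) (sym (ℕtoℚ-suc (suc b))) ⟩
  ℕtoℚ (suc (suc b)) * (x - y) * X     ∎
  where
  open QP.≤-Reasoning
  X = x ^ℚ suc b
  W = ℕtoℚ (suc b) * (x - y) * x ^ℚ b
  0≤x-y : 0ℚ ≤ℚ x - y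
  0≤x-y = QP.≤-trans (QP.≤-reflexive (sym (QP.+-inverseʳ y))) (QP.+-monoˡ-≤ (- y) y≤x)
  0≤W : 0ℚ ≤ℚ W
  0≤W = 0≤* (0≤* (0≤ℕtoℚ (suc b)) 0≤x-y) (^ℚ-nonneg b (QP.≤-trans 0≤y y≤x))

inv*ℕ-suc≤2 : ∀ M → inv (suc M) * ℕtoℚ (suc (suc M)) ≤ℚ 1ℚ + 1ℚ
inv*ℕ-suc≤2 M = begin
  inv (suc M) * ℕtoℚ (suc (suc M))                ≡⟨ cong (inv (suc M) *_) (ℕtoℚ-suc (suc M)) ⟩
  inv (suc M) * (1ℚ + ℕtoℚ (suc M))               ≡⟨ QP.*-distribˡ-+ (inv (suc M)) 1ℚ (ℕtoℚ (suc M)) ⟩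
  inv (suc M) * 1ℚ + inv (suc M) * ℕtoℚ (suc M)   ≡⟨ cong₂ _+_ (QP.*-identityʳ (inv (suc M))) (inv*ℕ≡1 M) ⟩
  inv (suc M) + 1ℚ                                ≤⟨ QP.+-monoˡ-≤ 1ℚ (inv-antimono {0} {M} z≤n) ⟩
  1ℚ + 1ℚ                                         ∎
  where open QP.≤-Reasoning

H-power-bound : ∀ b → ∃ λ c → ∀ M → H M ^ℚ b ≤ℚ ℕtoℚ c * ℕtoℚ (suc M)
H-power-bound zero = 1 , λ M → QP.≤-trans (1≤ℕtoℚ-suc M) (QP.≤-reflexive (sym (QP.*-identityˡ (ℕtoℚ (suc M)))))
H-power-bound (suc b) = c′ , λ M → QP.≤-trans (bound M) (*-monoˡ-nonneg (ℕtoℚ c′) (0≤ℕtoℚ c′) (ℕtoℚ-mono (ℕP.n≤1+n M)))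
  where
  c = proj₁ (H-power-bound b)
  H^b≤ = proj₂ (H-power-bound b)
  c′ = suc b ℕ.* c ℕ.* 2
  c′≡ : ℕtoℚ c′ ≡ ℕtoℚ (suc b) * ℕtoℚ c * (1ℚ + 1ℚ)
  c′≡ = trans (ℕtoℚ-* (suc b ℕ.* c) 2) (cong₂ _*_ (ℕtoℚ-* (suc b) c) (ℕtoℚ-suc 1))
  -- induction on M, each step costing at most (b+1)·c·(M+2)/(M+1) ≤ c′
  bound : ∀ M → H M ^ℚ suc b ≤ℚ ℕtoℚ c′ * ℕtoℚ M
  bound zero    = QP.≤-reflexive (trans (QP.*-zeroˡ (0ℚ ^ℚ b)) (sym (QP.*-zeroʳ (ℕtoℚ c′))))
  bound (suc M) = begin
    x ^ℚ suc b
      ≡⟨ solve 2 (λ a b → a := b :+ (a :- b)) refl (x ^ℚ suc b) (y ^ℚ suc b) ⟩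
    y ^ℚ suc b + (x ^ℚ suc b - y ^ℚ suc b)
      ≤⟨ QP.+-mono-≤ (bound M) (power-difference-bound b x y (0≤H M) (H-step M)) ⟩
    C′M + B * (x - y) * x ^ℚ b
      ≡⟨ cong (λ z → C′M + B * z * x ^ℚ b) (solve 2 (λ y i → (y :+ i) :- y := i) refl y i) ⟩
    C′M + B * i * x ^ℚ b
      ≤⟨ QP.+-monoʳ-≤ C′M (*-monoˡ-nonneg (B * i) (0≤* (0≤ℕtoℚ (suc b)) (0≤inv (suc M))) (H^b≤ (suc M))) ⟩
    C′M + B * i * (ℕtoℚ c * ℕtoℚ (suc (suc M)))
      ≡⟨ cong (C′M +_) (solve 4 (λ k i c n → k :* i :* (c :* n) := (k :* c) :* (i :* n)) refl B i (ℕtoℚ c) (ℕtoℚ (suc (suc M)))) ⟩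
    C′M + (B * ℕtoℚ c) * (i * ℕtoℚ (suc (suc M)))
      ≤⟨ QP.+-monoʳ-≤ C′M (*-monoˡ-nonneg (B * ℕtoℚ c) (0≤* (0≤ℕtoℚ (suc b)) (0≤ℕtoℚ c)) (inv*ℕ-suc≤2 M)) ⟩
    C′M + (B * ℕtoℚ c) * (1ℚ + 1ℚ)
      ≡⟨ cong (C′M +_) (sym c′≡) ⟩
    C′M + ℕtoℚ c′
      ≡⟨ trans (solve 2 (λ c m → c :* m :+ c := c :* (con 1ℚ :+ m)) refl (ℕtoℚ c′) (ℕtoℚ M)) (cong (ℕtoℚ c′ *_) (sym (ℕtoℚ-suc M))) ⟩
    ℕtoℚ c′ * ℕtoℚ (suc M) ∎
    where
    open QP.≤-Reasoning
    y = H M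
    i = inv (suc M)
    x = H (suc M)
    B = ℕtoℚ (suc b)
    C′M = ℕtoℚ c′ * ℕtoℚ M

positive-as-fraction : ∀ δ → 0ℚ < δ → ∃ λ q → ∃ λ p → δ * ℕtoℚ (suc q) ≡ ℕtoℚ (suc p)
positive-as-fraction δ@(mkℚ (ℤ.+ suc p) d _) _ = d , p , QP.toℚᵘ-injective (begin
  toℚᵘ (δ * ℕtoℚ (suc d))                        ≈⟨ QP.toℚᵘ-homo-* δ (ℕtoℚ (suc d)) ⟩
  toℚᵘ δ UQ.* toℚᵘ (ℕtoℚ (suc d))                ≈⟨ UP.*-congˡ {toℚᵘ δ} (toℚᵘ-/ (ℤ.+ suc d) 0) ⟩
  UQ.mkℚᵘ (ℤ.+ suc p) d UQ.* UQ.mkℚᵘ (ℤ.+ suc d) 0 ≈⟨ UQ.*≡* (cross (ℤ.+ suc p) (ℤ.+ suc d)) ⟩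
  UQ.mkℚᵘ (ℤ.+ suc p) 0                          ≈⟨ UP.≃-sym (toℚᵘ-/ (ℤ.+ suc p) 0) ⟩
  toℚᵘ (ℕtoℚ (suc p))                            ∎)
  where
  open UP.≃-Reasoning
  cross : ∀ P D → P ℤ.* D ℤ.* ℤ.+ 1 ≡ P ℤ.* (D ℤ.* ℤ.+ 1)
  cross = solve-∀
positive-as-fraction (mkℚ (ℤ.+ zero) _ _)  (Q.*<* (ℤ.+<+ ()))
positive-as-fraction (mkℚ ℤ.-[1+ _ ] _ _) (Q.*<* ())

archimedean : ∀ c δ → 0ℚ < δ → ∃ λ M₀ → ∀ M → M₀ ≤ M → ℕtoℚ c * inv (suc M) < δ
archimedean c δ 0<δ = c ℕ.* suc q , λ M M₀≤M → begin-strict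
  ℕtoℚ c * inv (suc M)                  <⟨ QP.*-monoˡ-<-pos (inv (suc M)) {{Q.positive (0<inv M)}} (c<δ[M+1] M M₀≤M) ⟩
  (δ * ℕtoℚ (suc M)) * inv (suc M)      ≡⟨ trans (QP.*-assoc δ _ _) (trans (cong (δ *_) (ℕ*inv≡1 M)) (QP.*-identityʳ δ)) ⟩
  δ                                     ∎
  where
  open QP.≤-Reasoning
  q = proj₁ (positive-as-fraction δ 0<δ)
  p = proj₁ (proj₂ (positive-as-fraction δ 0<δ))
  δ[q+1]≡p+1 = proj₂ (proj₂ (positive-as-fraction δ 0<δ))
  c<δ[M+1] : ∀ M → c ℕ.* suc q ≤ M → ℕtoℚ c < δ * ℕtoℚ (suc M)
  c<δ[M+1] M cq≤M = begin-strict
    ℕtoℚ c                          ≡⟨ sym (QP.*-identityʳ (ℕtoℚ c)) ⟩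
    ℕtoℚ c * 1ℚ                     ≤⟨ *-monoˡ-nonneg (ℕtoℚ c) (0≤ℕtoℚ c) (1≤ℕtoℚ-suc p) ⟩
    ℕtoℚ c * ℕtoℚ (suc p)           ≡⟨ cong (ℕtoℚ c *_) (sym δ[q+1]≡p+1) ⟩
    ℕtoℚ c * (δ * ℕtoℚ (suc q))     ≡⟨ solve 3 (λ c d q → c :* (d :* q) := d :* (c :* q)) refl (ℕtoℚ c) δ (ℕtoℚ (suc q)) ⟩
    δ * (ℕtoℚ c * ℕtoℚ (suc q))     ≡⟨ cong (δ *_) (sym (ℕtoℚ-* c (suc q))) ⟩
    δ * ℕtoℚ (c ℕ.* suc q)          ≤⟨ *-monoˡ-nonneg δ (QP.<⇒≤ 0<δ) (ℕtoℚ-mono cq≤M) ⟩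
    δ * ℕtoℚ M                      <⟨ QP.*-monoʳ-<-pos δ {{Q.positive 0<δ}}
                                         (QP.≤-<-trans (QP.≤-reflexive (sym (QP.+-identityˡ (ℕtoℚ M)))) (QP.+-monoˡ-< (ℕtoℚ M) 0<1)) ⟩
    δ * (1ℚ + ℕtoℚ M)               ≡⟨ cong (δ *_) (sym (ℕtoℚ-suc M)) ⟩
    δ * ℕtoℚ (suc M)                ∎

-- decay a M ≥ ε would give decay a M ² ≥ ε², while decay a M ² ≤ c/(M+1) by H-power-bound (2a).
decay-tends0 : ∀ a → Tends0 (decay a)
decay-tends0 a ε 0<ε = proj₁ large , λ M M₀≤M → below-ε M (proj₂ large M M₀≤M)
  where
  c = proj₁ (H-power-bound (a ℕ.+ a))
  H^2a≤ = proj₂ (H-power-bound (a ℕ.+ a))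
  large = archimedean c (ε * ε) (QP.≤-<-trans (QP.≤-reflexive (sym (QP.*-zeroˡ ε))) (QP.*-monoˡ-<-pos ε {{Q.positive 0<ε}} 0<ε))
  square-bound : ∀ M → decay a M * decay a M ≤ℚ ℕtoℚ c * inv (suc M)
  square-bound M = begin
    x * x                               ≡⟨ solve 3 (λ p q i → (p :* i) :* (q :* i) := (p :* q) :* (i :* i)) refl (H M ^ℚ a) (H M ^ℚ a) i ⟩
    (H M ^ℚ a * H M ^ℚ a) * (i * i)     ≡⟨ cong (_* (i * i)) (sym (^ℚ-+ (H M) a a)) ⟩
    H M ^ℚ (a ℕ.+ a) * (i * i)          ≤⟨ *-monoʳ-nonneg (i * i) (0≤* (0≤inv (suc M)) (0≤inv (suc M))) (H^2a≤ M) ⟩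
    (ℕtoℚ c * ℕtoℚ (suc M)) * (i * i)   ≡⟨ solve 3 (λ c n i → (c :* n) :* (i :* i) := c :* i :* (i :* n)) refl (ℕtoℚ c) (ℕtoℚ (suc M)) i ⟩
    ℕtoℚ c * i * (i * ℕtoℚ (suc M))     ≡⟨ trans (cong (ℕtoℚ c * i *_) (inv*ℕ≡1 M)) (QP.*-identityʳ _) ⟩
    ℕtoℚ c * i                          ∎
    where
    open QP.≤-Reasoning
    x = decay a M
    i = inv (suc M)
  below-ε : ∀ M → ℕtoℚ c * inv (suc M) < ε * ε → ∣ decay a M ∣ < ε
  below-ε M small with decay a M Q.<? ε
  ... | yes x<ε = subst (_< ε) (sym (QP.0≤p⇒∣p∣≡p (0≤* (^ℚ-nonneg a (0≤H M)) (0≤inv (suc M))))) x<ε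
  ... | no  x≮ε = ⊥-elim (QP.<-irrefl refl (QP.≤-<-trans (*-mono-nonneg (QP.<⇒≤ 0<ε) (QP.<⇒≤ 0<ε) ε≤x ε≤x)
                                                       (QP.≤-<-trans (square-bound M) small)))
    where
    ε≤x : ε ≤ℚ decay a M
    ε≤x = QP.≮⇒≥ x≮ε

-- Domination by κ·decay, then closure under the sums and scalings building R and E.
Rterm-tends0 : ∀ ℓ j κ → Tends0 (λ N → Rterm N ℓ j κ)
Rterm-tends0 ℓ j κ = tends0-dominated (λ N → Rterm-bound N ℓ j κ)
  (tends0-scale (ℕtoℚ κ) (tends0-shift j (decay-tends0 (ℓ ∸ j))))

R-tends0 : ∀ ℓ k → Tends0 (λ N → R N ℓ k)
R-tends0 ℓ k = tends0-Σ₀ ℓ (λ j N → nest j k (Rterm N ℓ j)) (λ j → tends0-nest j k (λ N κ → Rterm N ℓ j κ) (Rterm-tends0 ℓ j))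

E-tends0 : ∀ r s ℓ → Tends0 (λ N → E r s ℓ N)
E-tends0 r s ℓ = tends0-scale (neg1^ (suc s)) (tends0-Σ₁ r (λ k N → coefficient k * R N ℓ k)
  (λ k → tends0-scale (coefficient k) (R-tends0 ℓ k)))
  where
  coefficient : ℕ → ℚ
  coefficient k = binomQ r k * neg1^ (suc k) * inv (k ^ (s ∸ 1))

theorem2 : (r₁ r₂ ℓ₂ : ℕ) → 1 ≤ r₁ → 1 ≤ r₂ →
    ((N : ℕ) → ℓ₂ ≤ N →
      S r₁ r₂ ℓ₂ N ≡ mainSum r₁ r₂ ℓ₂ N + K r₁ r₂ ℓ₂ + E r₁ r₂ ℓ₂ N)
    × ((ε : ℚ) → 0ℚ < ε → ∃ λ N₀ → (N : ℕ) → N₀ ≤ N → ∣ E r₁ r₂ ℓ₂ N ∣ < ε)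
theorem2 (suc r) (suc t) ℓ _ _ = (λ N ℓ≤N → identity t r ℓ N ℓ≤N) , E-tends0 (suc r) (suc t) ℓ
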